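{- For all $m,n\in\mathbb{P}$, $$K_{0^m}\cdot K_{0^n}=\sum_{k=0}^m(-1)^k\binom{m+n-k}{m}\binom{m}{k}\frac{m+n-2k}{m+n-k}K_{0^{m+n-2k}}.$$
   Context: $\mathbb{N}=\{0,1,2,\dots\}$, $\mathbb{P}=\{1,2,\dots\}$. $\mathbb{Z}[[x_1,x_2,\dots]]_{\mathbb{N}}$: formal power series whose monomials are finite products $\prod_{i\in I}x_i^{a_i}$ ($a_i\in\mathbb{N}$), where $x_i^0$ is a formal symbol distinct from $1$ and $x_i^ax_i^b=x_i^{a+b}$ (so $x_i^0x_i^0=x_i^0$). Order $\mathbb{Z}\setminus\{0\}$ by $-1\prec1\prec-2\prec2\prec\cdots$. For $r\in\mathbb{P}$, $K_{0^r}=\sum_f x_{|f(1)|}^0\cdots x_{|f(r)|}^0$, summed over all $f:\{1,\dots,r\}\to\mathbb{Z}\setminus\{0\}$ with $f(1)\preceq\dots\preceq f(r)$ such that $f(j)=f(j+1)$ never holds with a negative value (the enriched partitions of the chain $1<2<\dots<r$); $K_{0^0}=1$. Equivalently $K_{0^r}=\sum_{j=1}^r2^j\binom{r-1}{j-1}M_{0^j}$, where $M_{0^j}=\sum_{1\le i_1<\dots<i_j}x_{i_1}^0\cdots x_{i_j}^0$. -}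

module Defs where

open import Data.Bool using (Bool; true; false; _∧_; _∨_; not)
open import Data.Nat as ℕ using (ℕ; zero; suc; _≡ᵇ_; _<ᵇ_)
open import Data.Integer as ℤ using (ℤ; +_; -[1+_]; ∣_∣)
open import Data.List using (List; []; _∷_; map; concatMap; filter; length; foldr)
open import Data.Product using (_×_; _,_)
open import Data.Rational as ℚ using (ℚ; 0ℚ)
open import Relation.Nullary.Decidable using (T?)

-- Only monomials of the form  x_S^0 = ∏_{i ∈ S} x_i^0  (S a
-- finite subset of ℙ, x_∅^0 = 1) occur in the K_{0^r}, and
-- x_I^0 · x_J^0 = x_{I ∪ J}^0.  A finite set S ⊆ ℙ is represented by the
-- strictly increasing list of its elements (validity imposed in the
-- statement).  A series supported on such monomials is its coefficient
-- function.

Series : Set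
Series = List ℕ → ℚ

sumℚ : List ℚ → ℚ
sumℚ = foldr ℚ._+_ 0ℚ

allᵇ : {A : Set} → (A → Bool) → List A → Bool
allᵇ p []       = true
allᵇ p (x ∷ xs) = p x ∧ allᵇ p xs

anyᵇ : {A : Set} → (A → Bool) → List A → Bool
anyᵇ p []       = false
anyᵇ p (x ∷ xs) = p x ∨ anyᵇ p xs

elemᵇ : ℕ → List ℕ → Bool
elemᵇ x []       = false
elemᵇ x (y ∷ ys) = (x ≡ᵇ y) ∨ elemᵇ x ys

sublists : List ℕ → List (List ℕ)
sublists []       = [] ∷ []
sublists (x ∷ xs) = let r = sublists xs in map (x ∷_) r Data.List.++ r

unionIs : List ℕ → List ℕ × List ℕ → Bool
unionIs S (I , J) = allᵇ (λ s → elemᵇ s I ∨ elemᵇ s J) S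

_·_ : Series → Series → Series
(f · g) S = sumℚ (map (λ { (I , J) → f I ℚ.* g J })
                      (filter (λ p → T? (unionIs S p))
                              (concatMap (λ I → map (I ,_) (sublists S)) (sublists S))))

-- The total order  -1 ≺ 1 ≺ -2 ≺ 2 ≺ …  on ℤ∖{0}, via the rank function
-- key(-i) = 2i, key(i) = 2i+1.
key : ℤ → ℕ
key (+ n)      = 2 ℕ.* n ℕ.+ 1
key -[1+ n ]   = 2 ℕ.* suc n

isNeg : ℤ → Bool
isNeg (+ _)    = false
isNeg -[1+ _ ] = true

stepOK : ℤ → ℤ → Bool
stepOK a b = (key a <ᵇ key b) ∨ ((key a ≡ᵇ key b) ∧ not (isNeg a))

enrichedᵇ : List ℤ → Bool
enrichedᵇ []           = true
enrichedᵇ (a ∷ [])     = true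
enrichedᵇ (a ∷ b ∷ w)  = stepOK a b ∧ enrichedᵇ (b ∷ w)

-- All functions {1,…,r} → A, as words of length r.
words : {A : Set} → ℕ → List A → List (List A)
words zero    L = [] ∷ []
words (suc r) L = concatMap (λ a → map (a ∷_) (words r L)) L

signed : List ℕ → List ℤ
signed = concatMap (λ i → ℤ.- (+ i) ∷ + i ∷ [])

-- f contributes the monomial x_{|f(1)|}^0 ⋯ x_{|f(r)|}^0 = x_S^0 iff
-- {|f(1)|,…,|f(r)|} = S.  Values are drawn from ±S, so it remains to
-- require that every element of S is hit.
coversᵇ : List ℕ → List ℤ → Bool
coversᵇ S w = allᵇ (λ s → anyᵇ (λ z → ∣ z ∣ ≡ᵇ s) w) S

-- Coefficient of x_S^0 in K_{0^r}: the number of enriched partitions f of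
-- the r-chain with {|f(j)|} = S.  (For r = 0 this gives K_{0^0} = 1.)
Kcoef : ℕ → List ℕ → ℕ
Kcoef r S = length (filter (λ w → T? (enrichedᵇ w ∧ coversᵇ S w))
                           (words r (signed S)))

K0 : ℕ → Series
K0 r S = + Kcoef r S ℚ./ 1

-- a / d in ℚ (only used with d ≠ 0; returns 0 for d = 0).
frac : ℤ → ℕ → ℚ
frac a zero    = 0ℚ
frac a (suc d) = a ℚ./ suc d

module Submission where

open import Defs
open import Data.Nat using (ℕ; _≤_; _<_; _+_; _∸_; _*_)
open import Data.Nat.Combinatorics using (_C_)
open import Data.Integer as ℤ using (+_)
open import Data.Rational as ℚ using (ℚ)
open import Data.List using (List; map; upTo)
open import Data.List.Relation.Unary.All using (All)
open import Data.List.Relation.Unary.Linked using (Linked)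
open import Relation.Binary.PropositionalEquality using (_≡_)

open import Data.Nat using (zero; suc; z≤n; s≤s; _≤?_; _<?_; _≡ᵇ_; _<ᵇ_)
import Data.Nat.Properties as ℕP
open import Data.Nat.Combinatorics using (nCk+nC[k+1]≡[n+1]C[k+1])
open import Data.Nat.ListAction using (sum)
import Data.Nat.ListAction.Properties as ℕLP
open import Data.Nat.Tactic.RingSolver as ℕSolver using ()
open import Data.Integer using (ℤ; -[1+_]; ∣_∣)
import Data.Integer.Properties as ℤP
open import Data.Integer.Tactic.RingSolver as ℤSolver using ()
open import Data.Rational using (0ℚ; toℚᵘ)
import Data.Rational.Properties as ℚP
open import Data.Rational.Solver renaming (module +-*-Solver to ℚSolver)
open import Data.Rational.Unnormalised using (mkℚᵘ; *≡*; _≃_)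
import Data.Rational.Unnormalised.Properties as ℚᵘP
open import Data.Bool using (Bool; true; false; _∧_; _∨_; T; if_then_else_)
import Data.Bool.Properties as BoolP
open import Data.List using ([]; _∷_; filter; length; _++_; concatMap; applyUpTo)
import Data.List.Properties as ListP
open import Data.List.Relation.Unary.All as All using ([]; _∷_)
import Data.List.Relation.Unary.All.Properties as AllP
open import Data.List.Relation.Unary.AllPairs using (AllPairs; []; _∷_)
open import Data.List.Relation.Unary.Linked.Properties using (Linked⇒AllPairs)
open import Data.Product using (_×_; _,_)
open import Data.Sum using (_⊎_; inj₁; inj₂)
open import Data.Empty using (⊥; ⊥-elim)
open import Data.Unit using (tt)
open import Function using (_∘_)
open import Relation.Nullary using (¬_; yes; no)
open import Relation.Nullary.Decidable using (T?)
open import Relation.Binary.Definitions using (tri<; tri≈; tri>)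
open import Relation.Binary.PropositionalEquality using (refl; sym; trans; cong; cong₂; subst; module ≡-Reasoning)
open import Algebra.Properties.Group ℚP.+-0-group using () renaming (∙-cancelˡ to ℚ-+-cancelˡ)
open import Algebra.Properties.AbelianGroup ℤP.+-0-abelianGroup using () renaming (∙-cancelʳ to ℤ-+-cancelʳ)
open import Algebra.Bundles using (CommutativeMonoid)
open import Algebra.Properties.CommutativeSemigroup (CommutativeMonoid.commutativeSemigroup ℚP.+-0-commutativeMonoid)
  using () renaming (interchange to ℚ-+-interchange)

-- All series involved have coefficients depending only on |S|, and the proof
-- works with these coefficient sequences:
--  1. Counting enriched words by their first letter: [x_S^0] K_{0^r} = mcoef r |S|
--     with mcoef r t = 2^t C(r-1,t-1), given by a Pascal-type recursion.
--  2. For such series the product is an operation ⊛ on sequences: split off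
--     min S, which lies in I ∩ J, in I only or in J only.
--  3. The binomial transform f ↦ (s ↦ Σ_j C(s,j) f j) is injective, turns ⊛ into
--     pointwise multiplication, and maps mcoef r to kspec r, which satisfies
--     kspec (r+1) (s+1) = kspec (r+1) s + kspec r (s+1) + kspec r s.
--  4. Over ℤ, kspec m s · kspec n s = Σ_k coef m n k · kspec (m+n-2k) s, where
--     coef m n k = (-1)^k (C(m+n-k,m) C(m,k) - C(m+n-k-1,m-1) C(m-1,k-1)):
--     both sides satisfy one recurrence in (s, m, n), by Pascal's rule, and
--     agree on the boundary s = 0, m = 0, n = 0.
--  5. By absorption coef m n k is the statement's coefficient (n ≥ 1); inverting
--     the transform and returning to series gives the theorem.

-- The embedding ℤ → ℚ is a ring homomorphism.  Since ℚ is normalised, this is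
-- checked in the unnormalised rationals, where  i / (n+1)  is the pair (i , n).

fromℤ : ℤ → ℚ
fromℤ i = i ℚ./ 1

fromℕ : ℕ → ℚ
fromℕ n = fromℤ (+ n)

toℚᵘ-/ : ∀ i n → toℚᵘ (i ℚ./ suc n) ≃ mkℚᵘ i n
toℚᵘ-/ i n = scaled (i ℚ./ suc n) (ℚP.↥-/ i (suc n)) (ℚP.↧-/ i (suc n))
  where
  scaled : ∀ p {g} → ℚ.↥ p ℤ.* g ≡ i → ℚ.↧ p ℤ.* g ≡ + suc n → toℚᵘ p ≃ mkℚᵘ i n
  scaled (ℚ.mkℚ a b _) {g} refl ↧g = *≡* (begin
    a ℤ.* + suc n          ≡⟨ cong (a ℤ.*_) (sym ↧g) ⟩
    a ℤ.* (+ suc b ℤ.* g)  ≡⟨ rearrange a (+ suc b) g ⟩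
    a ℤ.* g ℤ.* + suc b    ∎)
    where
    open ≡-Reasoning
    rearrange : ∀ x y z → x ℤ.* (y ℤ.* z) ≡ x ℤ.* z ℤ.* y
    rearrange = ℤSolver.solve-∀

fromℤ-≃ : ∀ i → toℚᵘ (fromℤ i) ≃ mkℚᵘ i 0
fromℤ-≃ i = toℚᵘ-/ i 0

fromℤ-+ : ∀ i j → fromℤ (i ℤ.+ j) ≡ fromℤ i ℚ.+ fromℤ j
fromℤ-+ i j = ℚP.toℚᵘ-injective (ℚᵘP.≃-trans (fromℤ-≃ (i ℤ.+ j)) (ℚᵘP.≃-sym (ℚᵘP.≃-trans
  (ℚP.toℚᵘ-homo-+ (fromℤ i) (fromℤ j))
  (ℚᵘP.≃-trans (ℚᵘP.+-cong (fromℤ-≃ i) (fromℤ-≃ j)) (*≡* (identity i j))))))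
  where
  identity : ∀ x y → (x ℤ.* + 1 ℤ.+ y ℤ.* + 1) ℤ.* + 1 ≡ (x ℤ.+ y) ℤ.* (+ 1 ℤ.* + 1)
  identity = ℤSolver.solve-∀

fromℤ-* : ∀ i j → fromℤ (i ℤ.* j) ≡ fromℤ i ℚ.* fromℤ j
fromℤ-* i j = ℚP.toℚᵘ-injective (ℚᵘP.≃-trans (fromℤ-≃ (i ℤ.* j)) (ℚᵘP.≃-sym (ℚᵘP.≃-trans
  (ℚP.toℚᵘ-homo-* (fromℤ i) (fromℤ j))
  (ℚᵘP.≃-trans (ℚᵘP.*-cong (fromℤ-≃ i) (fromℤ-≃ j)) (*≡* (identity i j))))))
  where
  identity : ∀ x y → (x ℤ.* y) ℤ.* + 1 ≡ (x ℤ.* y) ℤ.* (+ 1 ℤ.* + 1)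
  identity = ℤSolver.solve-∀

fromℕ-+ : ∀ p q → fromℕ (p + q) ≡ fromℕ p ℚ.+ fromℕ q
fromℕ-+ p q = trans (cong fromℤ (ℤP.pos-+ p q)) (fromℤ-+ (+ p) (+ q))

fromℕ-* : ∀ p q → fromℕ (p * q) ≡ fromℕ p ℚ.* fromℕ q
fromℕ-* p q = trans (cong fromℤ (ℤP.pos-* p q)) (fromℤ-* (+ p) (+ q))

frac-multiple : ∀ c {d} → 0 < d → frac (c ℤ.* + d) d ≡ fromℤ c
frac-multiple c {suc d} _ = ℚP.toℚᵘ-injective (ℚᵘP.≃-trans (toℚᵘ-/ (c ℤ.* + suc d) d)
  (ℚᵘP.≃-trans (*≡* (identity c (+ suc d))) (ℚᵘP.≃-sym (fromℤ-≃ c))))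
  where
  identity : ∀ x y → x ℤ.* y ℤ.* + 1 ≡ x ℤ.* y
  identity = ℤSolver.solve-∀

-- Binomial coefficients by Pascal's rule; they agree with the library's _C_,
-- but their recursion is definitional, which the inductions below need.
bin : ℕ → ℕ → ℕ
bin _       zero    = 1
bin zero    (suc k) = 0
bin (suc n) (suc k) = bin n k + bin n (suc k)

bin≡C : ∀ n k → bin n k ≡ n C k
bin≡C n       zero    = refl
bin≡C zero    (suc k) = refl
bin≡C (suc n) (suc k) =
  trans (cong₂ _+_ (bin≡C n k) (bin≡C n (suc k))) (nCk+nC[k+1]≡[n+1]C[k+1] n k)

bin-above : ∀ n k → n < k → bin n k ≡ 0
bin-above zero    (suc k) _         = refl
bin-above (suc n) (suc k) (s≤s n<k) =
  cong₂ _+_ (bin-above n k n<k) (bin-above n (suc k) (ℕP.m<n⇒m<1+n n<k))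

bin-diagonal : ∀ n → bin n n ≡ 1
bin-diagonal zero    = refl
bin-diagonal (suc n) = cong₂ _+_ (bin-diagonal n) (bin-above n (suc n) (ℕP.n<1+n n))

bin-absorb : ∀ n k → bin (suc n) (suc k) * suc k ≡ suc n * bin n k
bin-absorb n       zero    = cong (_* 1) (bin-one (suc n))
  where
  bin-one : ∀ n → bin n 1 ≡ n
  bin-one zero    = refl
  bin-one (suc n) = cong suc (bin-one n)
bin-absorb zero    (suc k) = refl
bin-absorb (suc n) (suc k) = begin
  (a + b) * suc (suc k)                         ≡⟨ split a b k ⟩
  a * suc k + a + b * suc (suc k)               ≡⟨ cong₂ (λ x y → x + a + y) (bin-absorb n k) (bin-absorb n (suc k)) ⟩
  suc n * bin n k + a + suc n * bin n (suc k)   ≡⟨ merge n (bin n k) (bin n (suc k)) ⟩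
  suc (suc n) * (bin n k + bin n (suc k))       ∎
  where
  open ≡-Reasoning
  a = bin (suc n) (suc k)
  b = bin (suc n) (suc (suc k))
  split : ∀ a b k → (a + b) * (2 + k) ≡ a * (1 + k) + a + b * (2 + k)
  split = ℕSolver.solve-∀
  merge : ∀ n x y → (1 + n) * x + (x + y) + (1 + n) * y ≡ (2 + n) * (x + y)
  merge = ℕSolver.solve-∀

≡ᵇ-refl : ∀ x → (x ≡ᵇ x) ≡ true
≡ᵇ-refl zero    = refl
≡ᵇ-refl (suc x) = ≡ᵇ-refl x

<⇒≢ᵇ : ∀ {m n} → m < n → (m ≡ᵇ n) ≡ false
<⇒≢ᵇ {zero}  {suc n} _         = refl
<⇒≢ᵇ {suc m} {suc n} (s≤s m<n) = <⇒≢ᵇ m<n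

>⇒≢ᵇ : ∀ {m n} → n < m → (m ≡ᵇ n) ≡ false
>⇒≢ᵇ {suc m} {zero}  _         = refl
>⇒≢ᵇ {suc m} {suc n} (s≤s n<m) = >⇒≢ᵇ n<m

allᵇ-cong : {A : Set} {p q : A → Bool} {xs : List A} →
            All (λ x → p x ≡ q x) xs → allᵇ p xs ≡ allᵇ q xs
allᵇ-cong []       = refl
allᵇ-cong (h ∷ hs) = cong₂ _∧_ h (allᵇ-cong hs)

count : (List ℤ → Bool) → ℕ → List ℤ → ℕ
count P r L = length (filter (λ w → T? (P w)) (words r L))

countIn : (List ℤ → Bool) → List (List ℤ) → ℕ
countIn P ws = length (filter (λ w → T? (P w)) ws)

countIn-map : ∀ P (a : ℤ) ws → countIn P (map (a ∷_) ws) ≡ countIn (P ∘ (a ∷_)) ws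
countIn-map P a []       = refl
countIn-map P a (w ∷ ws) with P (a ∷ w)
... | true  = cong suc (countIn-map P a ws)
... | false = countIn-map P a ws

sumOver : (ℤ → ℕ) → List ℤ → ℕ
sumOver F L = sum (map F L)

count-suc : ∀ P r L → count P (suc r) L ≡ sumOver (λ a → count (P ∘ (a ∷_)) r L) L
count-suc P r L = byFirstLetter L
  where
  byFirstLetter : ∀ M → countIn P (concatMap (λ a → map (a ∷_) (words r L)) M)
                        ≡ sumOver (λ a → count (P ∘ (a ∷_)) r L) M
  byFirstLetter []      = refl
  byFirstLetter (a ∷ M) = begin
    length (filter _ (map (a ∷_) (words r L) ++ _))
      ≡⟨ cong length (ListP.filter-++ (λ w → T? (P w)) (map (a ∷_) (words r L)) _) ⟩
    length (filter _ (map (a ∷_) (words r L)) ++ _)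
      ≡⟨ ListP.length-++ (filter (λ w → T? (P w)) (map (a ∷_) (words r L))) ⟩
    countIn P (map (a ∷_) (words r L)) + _
      ≡⟨ cong₂ _+_ (countIn-map P a (words r L)) (byFirstLetter M) ⟩
    count (P ∘ (a ∷_)) r L + sumOver (λ a → count (P ∘ (a ∷_)) r L) M ∎
    where open ≡-Reasoning

count-cong : ∀ {P Q} r L → (∀ w → P w ≡ Q w) → count P r L ≡ count Q r L
count-cong {P} {Q} r L P≗Q = go (words r L)
  where
  go : ∀ ws → countIn P ws ≡ countIn Q ws
  go []       = refl
  go (w ∷ ws) rewrite P≗Q w with Q w
  ... | true  = cong suc (go ws)
  ... | false = go ws

count-none : ∀ {P} r L → (∀ w → P w ≡ false) → count P r L ≡ 0
count-none {P} r L none = go (words r L)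
  where
  go : ∀ ws → countIn P ws ≡ 0
  go []       = refl
  go (w ∷ ws) rewrite none w = go ws

sumOver-zero : ∀ F L → All (λ a → F a ≡ 0) L → sumOver F L ≡ 0
sumOver-zero F []      []       = refl
sumOver-zero F (a ∷ L) (h ∷ hs) rewrite h = sumOver-zero F L hs

count-restrict : ∀ r L₁ L₂ P → All (λ l → ∀ u w → P (u ++ l ∷ w) ≡ false) L₁ →
                 count P r (L₁ ++ L₂) ≡ count P r L₂
count-restrict zero    L₁ L₂ P dead = refl
count-restrict (suc r) L₁ L₂ P dead = begin
  count P (suc r) (L₁ ++ L₂)               ≡⟨ count-suc P r (L₁ ++ L₂) ⟩
  sum (map F (L₁ ++ L₂))                   ≡⟨ cong sum (ListP.map-++ F L₁ L₂) ⟩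
  sum (map F L₁ ++ map F L₂)               ≡⟨ ℕLP.sum-++ (map F L₁) (map F L₂) ⟩
  sumOver F L₁ + sumOver F L₂              ≡⟨ cong₂ _+_ killed (sumOver-cong L₂) ⟩
  0 + sumOver (λ a → count (P ∘ (a ∷_)) r L₂) L₂ ≡⟨ count-suc P r L₂ ⟨
  count P (suc r) L₂                       ∎
  where
  open ≡-Reasoning
  F : ℤ → ℕ
  F a = count (P ∘ (a ∷_)) r (L₁ ++ L₂)
  killed : sumOver F L₁ ≡ 0
  killed = sumOver-zero F L₁ (All.map (λ d → count-none r _ (d [])) dead)
  sumOver-cong : ∀ M → sumOver F M ≡ sumOver (λ a → count (P ∘ (a ∷_)) r L₂) M
  sumOver-cong []      = refl
  sumOver-cong (a ∷ M) = cong₂ _+_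
    (count-restrict r L₁ L₂ (P ∘ (a ∷_)) (All.map (λ d u → d (a ∷ u)) dead)) (sumOver-cong M)

Follows : ℤ → ℤ → Set
Follows a c = (key a < key c) ⊎ (key a ≡ key c × isNeg a ≡ false)

stepOK⇒Follows : ∀ a c → stepOK a c ≡ true → Follows a c
stepOK⇒Follows a c ok with key a <ᵇ key c in lt | key a ≡ᵇ key c in eq | isNeg a in neg
... | true  | _    | _     = inj₁ (ℕP.<ᵇ⇒< (key a) (key c) (subst T (sym lt) tt))
... | false | true | false = inj₂ (ℕP.≡ᵇ⇒≡ (key a) (key c) (subst T (sym eq) tt) , refl)

T⇒≡true : ∀ {b} → T b → b ≡ true
T⇒≡true {true} _ = refl

Follows⇒stepOK : ∀ a c → Follows a c → stepOK a c ≡ true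
Follows⇒stepOK a c (inj₁ lt) rewrite T⇒≡true (ℕP.<⇒<ᵇ lt) = refl
Follows⇒stepOK a c (inj₂ (eq , pos)) rewrite eq | pos | ≡ᵇ-refl (key c) =
  BoolP.∨-zeroʳ (key c <ᵇ key c)

¬Follows⇒stepOK : ∀ a c → ¬ Follows a c → stepOK a c ≡ false
¬Follows⇒stepOK a c ¬f with stepOK a c in ok
... | true  = ⊥-elim (¬f (stepOK⇒Follows a c ok))
... | false = refl

Follows-trans : ∀ a c l → Follows a c → Follows c l → Follows a l
Follows-trans a c l (inj₁ x)       (inj₁ y)        = inj₁ (ℕP.<-trans x y)
Follows-trans a c l (inj₁ x)       (inj₂ (e , _))  = inj₁ (subst (key a <_) e x)
Follows-trans a c l (inj₂ (e , _)) (inj₁ y)        = inj₁ (subst (_< key l) (sym e) y)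
Follows-trans a c l (inj₂ (e , n)) (inj₂ (e′ , _)) = inj₂ (trans e e′ , n)

-- By transitivity, if l cannot follow a then l cannot occur anywhere in an
-- enriched word starting with a.
never-after : ∀ a l u w → stepOK a l ≡ false → enrichedᵇ (a ∷ u ++ l ∷ w) ≡ false
never-after a l []      w bad rewrite bad = refl
never-after a l (c ∷ u) w bad with stepOK a c in ok
... | false = refl
... | true  = never-after c l u w (¬Follows⇒stepOK c l λ c→l →
  true≢false (trans (sym (Follows⇒stepOK a l (Follows-trans a c l (stepOK⇒Follows a c ok) c→l))) bad))
  where
  true≢false : true ≡ false → ⊥
  true≢false ()

-- Absolute values weakly increase along an enriched word, so a value smaller
-- than the first absolute value is never covered.
Follows⇒∣≤∣ : ∀ b z → Follows b z → ∣ b ∣ ≤ ∣ z ∣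
Follows⇒∣≤∣ b z f = halve (∣ b ∣) (∣ z ∣) (ℕP.≤-trans (lower b) (ℕP.≤-trans (Follows⇒≤ f) (upper z)))
  where
  Follows⇒≤ : Follows b z → key b ≤ key z
  Follows⇒≤ (inj₁ lt)      = ℕP.<⇒≤ lt
  Follows⇒≤ (inj₂ (e , _)) = ℕP.≤-reflexive e
  lower : ∀ b → 2 * ∣ b ∣ ≤ key b
  lower (+ n)    = ℕP.m≤m+n (2 * n) 1
  lower -[1+ n ] = ℕP.≤-refl
  upper : ∀ z → key z ≤ 2 * ∣ z ∣ + 1
  upper (+ n)    = ℕP.≤-refl
  upper -[1+ n ] = ℕP.m≤m+n (2 * suc n) 1
  halve : ∀ p q → 2 * p ≤ 2 * q + 1 → p ≤ q
  halve zero    q       _ = z≤n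
  halve (suc p) zero    (s≤s le) rewrite ℕP.+-suc p (p + 0) with le
  ... | ()
  halve (suc p) (suc q) (s≤s le)
    rewrite ℕP.+-suc p (p + 0) | ℕP.+-suc q (q + 0) = s≤s (halve p q (ℕP.≤-pred le))

uncovered : ∀ t b w → t < ∣ b ∣ → enrichedᵇ (b ∷ w) ∧ anyᵇ (λ z → ∣ z ∣ ≡ᵇ t) (b ∷ w) ≡ false
uncovered t b []      t<b rewrite >⇒≢ᵇ t<b = refl
uncovered t b (z ∷ w) t<b with stepOK b z in ok
... | false = refl
... | true rewrite >⇒≢ᵇ t<b =
  uncovered t z w (ℕP.<-≤-trans t<b (Follows⇒∣≤∣ b z (stepOK⇒Follows b z ok)))

letter : Bool → ℕ → ℤ
letter true  x = -[1+ x ]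
letter false x = + suc x

∣letter∣ : ∀ σ x → ∣ letter σ x ∣ ≡ suc x
∣letter∣ true  x = refl
∣letter∣ false x = refl

key-letter-≤ : ∀ σ x → key (letter σ x) ≤ 2 * suc x + 1
key-letter-≤ true  x = ℕP.m≤m+n (2 * suc x) 1
key-letter-≤ false x = ℕP.≤-refl

key-letter-≥ : ∀ σ x → 2 * suc x ≤ key (letter σ x)
key-letter-≥ true  x = ℕP.≤-refl
key-letter-≥ false x = ℕP.m≤m+n (2 * suc x) 1

letter-< : ∀ σ τ x y → x < y → key (letter σ x) < key (letter τ y)
letter-< σ τ x y x<y = ℕP.≤-<-trans (key-letter-≤ σ x)
  (ℕP.<-≤-trans (ℕP.≤-reflexive (gap x) ) (ℕP.≤-trans (ℕP.*-monoʳ-≤ 2 (s≤s x<y)) (key-letter-≥ τ y)))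
  where
  gap : ∀ x → suc (2 * suc x + 1) ≡ 2 * suc (suc x)
  gap = ℕSolver.solve-∀

neg-not-after-same : ∀ σ x → stepOK (letter σ x) -[1+ x ] ≡ false
neg-not-after-same true  x = ¬Follows⇒stepOK -[1+ x ] -[1+ x ] λ
  { (inj₁ lt) → ℕP.<-irrefl refl lt ; (inj₂ (_ , ())) }
neg-not-after-same false x = ¬Follows⇒stepOK (+ suc x) -[1+ x ] λ
  { (inj₁ lt) → ℕP.<-asym lt (ℕP.m<m+n (2 * suc x) (s≤s z≤n))
  ; (inj₂ (e , _)) → ℕP.<-irrefl (sym e) (ℕP.m<m+n (2 * suc x) (s≤s z≤n)) }

pos-after-same : ∀ σ x → stepOK (letter σ x) (+ suc x) ≡ true
pos-after-same true  x = Follows⇒stepOK -[1+ x ] (+ suc x) (inj₁ (ℕP.m<m+n (2 * suc x) (s≤s z≤n)))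
pos-after-same false x = Follows⇒stepOK (+ suc x) (+ suc x) (inj₂ (refl , refl))

larger-after : ∀ σ τ x y → x < y → stepOK (letter σ x) (letter τ y) ≡ true
larger-after σ τ x y x<y = Follows⇒stepOK (letter σ x) (letter τ y) (inj₁ (letter-< σ τ x y x<y))

smaller-not-after : ∀ σ τ x y → x < y → stepOK (letter τ y) (letter σ x) ≡ false
smaller-not-after σ τ x y x<y = ¬Follows⇒stepOK (letter τ y) (letter σ x) λ
  { (inj₁ lt) → ℕP.<-asym (letter-< σ τ x y x<y) lt
  ; (inj₂ (e , _)) → ℕP.<-irrefl (sym e) (letter-< σ τ x y x<y) }

covers-skip : ∀ b x T w → ∣ b ∣ ≡ x → All (x <_) T → coversᵇ T (b ∷ w) ≡ coversᵇ T w
covers-skip b x T w refl T>x = allᵇ-cong (All.map (λ {s} x<s →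
  cong (_∨ anyᵇ (λ z → ∣ z ∣ ≡ᵇ s) w) (<⇒≢ᵇ x<s)) T>x)

covers-head : ∀ b T w → All (∣ b ∣ <_) T → coversᵇ (∣ b ∣ ∷ T) (b ∷ w) ≡ coversᵇ T w
covers-head b T w T>b rewrite ≡ᵇ-refl ∣ b ∣ = covers-skip b ∣ b ∣ T w refl T>b

signed-above : ∀ y T → All (y <_) T → All (λ c → y < ∣ c ∣) (signed T)
signed-above y []      []           = []
signed-above y (s ∷ T) (y<s ∷ T>y) = subst (y <_) (sym (ℤP.∣-i∣≡∣i∣ (+ s))) y<s ∷ y<s ∷ signed-above y T T>y

∧-killed : ∀ s e a r → e ∧ a ≡ false → (s ∧ e) ∧ (a ∧ r) ≡ false
∧-killed false e     a r _    = refl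
∧-killed true  false a r _    = refl
∧-killed true  true  a r e∧a rewrite e∧a = refl

-- After a first letter b of absolute value x+1, an enriched word over
-- ±(x+1 ∷ T) covering T (all of whose elements exceed x+1) continues with a
-- tail w satisfying tailOK b T.  Their number depends only on |w| = r and
-- t = |T|: the next letter is +(x+1) (repeating), or ±min T (after which
-- ±(x+1) can no longer occur); -(x+1) and letters above min T are impossible.
tailOK : ℤ → List ℕ → List ℤ → Bool
tailOK b T w = enrichedᵇ (b ∷ w) ∧ coversᵇ T w

tails : ℕ → ℕ → ℕ
tails r       zero    = 1
tails zero    (suc t) = 0
tails (suc r) (suc t) = tails r (suc t) + 2 * tails r t

tail-neg-same : ∀ σ x T r L → count (tailOK (letter σ x) T ∘ (-[1+ x ] ∷_)) r L ≡ 0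
tail-neg-same σ x T r L = count-none r L λ w →
  cong (λ s → (s ∧ enrichedᵇ (-[1+ x ] ∷ w)) ∧ coversᵇ T (-[1+ x ] ∷ w)) (neg-not-after-same σ x)

tail-pos-same : ∀ σ x T r L → All (suc x <_) T →
                count (tailOK (letter σ x) T ∘ (+ suc x ∷_)) r L ≡ count (tailOK (+ suc x) T) r L
tail-pos-same σ x T r L T>x = count-cong r L λ w →
  cong₂ (λ s c → (s ∧ enrichedᵇ (+ suc x ∷ w)) ∧ c) (pos-after-same σ x) (covers-skip (+ suc x) (suc x) T w refl T>x)

tail-next : ∀ σ τ x y T r → x < y → All (suc y <_) T →
            count (tailOK (letter σ x) (suc y ∷ T) ∘ (letter τ y ∷_)) r (signed (suc x ∷ suc y ∷ T))
            ≡ count (tailOK (letter τ y) T) r (signed (suc y ∷ T))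
tail-next σ τ x y T r x<y T>y = trans
  (count-cong r _ λ w → cong₂ (λ s d → (s ∧ enrichedᵇ (c ∷ w)) ∧ d) (larger-after σ τ x y x<y) (covered w))
  (count-restrict r (-[1+ x ] ∷ + suc x ∷ []) (signed (suc y ∷ T)) (tailOK c T)
    ((λ u w → cong (_∧ coversᵇ T (u ++ -[1+ x ] ∷ w)) (never-after c -[1+ x ] u w (smaller-not-after true τ x y x<y))) ∷
     (λ u w → cong (_∧ coversᵇ T (u ++ + suc x ∷ w)) (never-after c (+ suc x) u w (smaller-not-after false τ x y x<y))) ∷ []))
  where
  c = letter τ y
  covered : ∀ w → coversᵇ (suc y ∷ T) (c ∷ w) ≡ coversᵇ T w
  covered w = subst (λ v → coversᵇ (v ∷ T) (c ∷ w) ≡ coversᵇ T w) (∣letter∣ τ y)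
    (covers-head c T w (subst (λ v → All (v <_) T) (sym (∣letter∣ τ y)) T>y))

-- … but no letter above min T, since min T would stay uncovered.
tail-later : ∀ b y T r L → All (suc y <_) T →
             sumOver (λ c → count (tailOK b (suc y ∷ T) ∘ (c ∷_)) r L) (signed T) ≡ 0
tail-later b y T r L T>y = sumOver-zero _ (signed T) (All.map (λ {c} y<c → count-none r L λ w →
  ∧-killed (stepOK b c) (enrichedᵇ (c ∷ w)) _ _ (uncovered (suc y) c w y<c)) (signed-above (suc y) T T>y))

count-tails : ∀ r x T σ → AllPairs _<_ (suc x ∷ T) →
              count (tailOK (letter σ x) T) r (signed (suc x ∷ T)) ≡ tails r (length T)
count-tails zero    x []      σ _ = refl
count-tails zero    x (y ∷ T) σ _ = refl
count-tails (suc r) x []      σ (T>x ∷ T↑) = begin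
  count (tailOK (letter σ x) []) (suc r) L              ≡⟨ count-suc _ r L ⟩
  F -[1+ x ] + (F (+ suc x) + 0)                        ≡⟨ cong₂ (λ p q → p + (q + 0))
                                                           (tail-neg-same σ x [] r L) (tail-pos-same σ x [] r L []) ⟩
  0 + (count (tailOK (+ suc x) []) r L + 0)             ≡⟨ cong (λ p → p + 0) (count-tails r x [] false (T>x ∷ T↑)) ⟩
  1                                                     ∎
  where
  open ≡-Reasoning
  L = signed (suc x ∷ [])
  F = λ c → count (tailOK (letter σ x) [] ∘ (c ∷_)) r L
count-tails (suc r) x (suc y ∷ T) σ ((s≤s x<y ∷ T>x) ∷ (T>y ∷ T↑)) = begin
  count (tailOK (letter σ x) T′) (suc r) L
    ≡⟨ count-suc _ r L ⟩
  F -[1+ x ] + (F (+ suc x) + (F (letter true y) + (F (letter false y) + sumOver F (signed T))))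
    ≡⟨ cong₂ (λ p q → p + (q + (F (letter true y) + (F (letter false y) + sumOver F (signed T)))))
         (tail-neg-same σ x T′ r L) (trans (tail-pos-same σ x T′ r L (s≤s x<y ∷ T>x))
                                      (count-tails r x T′ false ((s≤s x<y ∷ T>x) ∷ (T>y ∷ T↑)))) ⟩
  0 + (tails r (suc t) + (F (letter true y) + (F (letter false y) + sumOver F (signed T))))
    ≡⟨ cong₂ (λ p q → 0 + (tails r (suc t) + (p + (q + sumOver F (signed T))))) (next true) (next false) ⟩
  0 + (tails r (suc t) + (tails r t + (tails r t + sumOver F (signed T))))
    ≡⟨ cong (λ z → 0 + (tails r (suc t) + (tails r t + (tails r t + z)))) (tail-later (letter σ x) y T r L T>y) ⟩
  0 + (tails r (suc t) + (tails r t + (tails r t + 0)))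
    ≡⟨ collect (tails r (suc t)) (tails r t) ⟩
  tails (suc r) (suc t) ∎
  where
  open ≡-Reasoning
  T′ = suc y ∷ T
  t = length T
  L = signed (suc x ∷ T′)
  F = λ c → count (tailOK (letter σ x) T′ ∘ (c ∷_)) r L
  next : ∀ τ → F (letter τ y) ≡ tails r t
  next τ = trans (tail-next σ τ x y T r x<y T>y) (count-tails r y T τ (T>y ∷ T↑))
  collect : ∀ p q → 0 + (p + (q + (q + 0))) ≡ p + 2 * q
  collect = ℕSolver.solve-∀

-- mcoef r t = 2^t·C(r-1,t-1) is the coefficient of M_{0^t} in K_{0^r}.
mcoef : ℕ → ℕ → ℕ
mcoef zero    zero    = 1
mcoef zero    (suc t) = 0
mcoef (suc r) zero    = 0
mcoef (suc r) (suc t) = mcoef r (suc t) + 2 * mcoef r t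

-- Starting with ±min S, an enriched word covering S is one of 2 · tails words.
mcoef-tails : ∀ r t → mcoef (suc r) (suc t) ≡ 2 * tails r t
mcoef-tails zero    zero    = refl
mcoef-tails zero    (suc t) = refl
mcoef-tails (suc r) zero    = cong (_+ 0) (mcoef-tails r zero)
mcoef-tails (suc r) (suc t) = trans (cong₂ (λ p q → p + 2 * q) (mcoef-tails r (suc t)) (mcoef-tails r t))
  (distrib (tails r (suc t)) (tails r t))
  where
  distrib : ∀ p q → 2 * p + 2 * (2 * q) ≡ 2 * (p + 2 * q)
  distrib = ℕSolver.solve-∀

-- The coefficient of x_S^0 in K_{0^r} only depends on |S|: an enriched word
-- covering S starts with ±min S, followed by a tail.
Kcoef-mcoef : ∀ r S → AllPairs _<_ S → All (1 ≤_) S → Kcoef r S ≡ mcoef r (length S)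
Kcoef-mcoef zero    []          _ _ = refl
Kcoef-mcoef (suc r) []          _ _ = refl
Kcoef-mcoef zero    (x ∷ S)     _ (s≤s z≤n ∷ _) = refl
Kcoef-mcoef (suc r) (suc x ∷ S) (S>x ∷ S↑) (s≤s z≤n ∷ _) = begin
  count top (suc r) L                                    ≡⟨ count-suc top r L ⟩
  F (letter true x) + (F (letter false x) + sumOver F (signed S))
    ≡⟨ cong₂ (λ p q → p + (q + sumOver F (signed S))) (first true) (first false) ⟩
  tails r t + (tails r t + sumOver F (signed S))
    ≡⟨ cong (λ z → tails r t + (tails r t + z)) later ⟩
  tails r t + (tails r t + 0)                            ≡⟨ mcoef-tails r t ⟨
  mcoef (suc r) (suc t)                                  ∎
  where
  open ≡-Reasoning
  t = length S
  top = λ w → enrichedᵇ w ∧ coversᵇ (suc x ∷ S) w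
  L = signed (suc x ∷ S)
  F = λ c → count (top ∘ (c ∷_)) r L
  first : ∀ σ → F (letter σ x) ≡ tails r t
  first σ = trans (count-cong r L λ w → cong (enrichedᵇ (letter σ x ∷ w) ∧_)
                     (subst (λ v → coversᵇ (v ∷ S) (letter σ x ∷ w) ≡ coversᵇ S w) (∣letter∣ σ x)
                        (covers-head (letter σ x) S w (subst (λ v → All (v <_) S) (sym (∣letter∣ σ x)) S>x))))
                  (count-tails r x S σ (S>x ∷ S↑))
  later : sumOver F (signed S) ≡ 0
  later = sumOver-zero F (signed S) (All.map (λ {c} x<c → count-none r L λ w →
    ∧-killed true (enrichedᵇ (c ∷ w)) _ _ (uncovered (suc x) c w x<c)) (signed-above (suc x) S S>x))

Σ[_]_ : {A : Set} → List A → (A → ℚ) → ℚ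
Σ[ xs ] f = sumℚ (map f xs)

Σ-++ : {A : Set} (xs ys : List A) (f : A → ℚ) → Σ[ xs ++ ys ] f ≡ Σ[ xs ] f ℚ.+ Σ[ ys ] f
Σ-++ []       ys f = sym (ℚP.+-identityˡ _)
Σ-++ (x ∷ xs) ys f = trans (cong (f x ℚ.+_) (Σ-++ xs ys f)) (sym (ℚP.+-assoc (f x) (Σ[ xs ] f) (Σ[ ys ] f)))

Σ-map : {A B : Set} (g : A → B) (xs : List A) (f : B → ℚ) → Σ[ map g xs ] f ≡ Σ[ xs ] (f ∘ g)
Σ-map g []       f = refl
Σ-map g (x ∷ xs) f = cong (f (g x) ℚ.+_) (Σ-map g xs f)

Σ-concatMap : {A B : Set} (F : A → List B) (xs : List A) (f : B → ℚ) →
              Σ[ concatMap F xs ] f ≡ Σ[ xs ] (λ x → Σ[ F x ] f)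
Σ-concatMap F []       f = refl
Σ-concatMap F (x ∷ xs) f = trans (Σ-++ (F x) (concatMap F xs) f) (cong (Σ[ F x ] f ℚ.+_) (Σ-concatMap F xs f))

Σ-cong : {A : Set} (xs : List A) {f g : A → ℚ} → (∀ x → f x ≡ g x) → Σ[ xs ] f ≡ Σ[ xs ] g
Σ-cong []       f≗g = refl
Σ-cong (x ∷ xs) f≗g = cong₂ ℚ._+_ (f≗g x) (Σ-cong xs f≗g)

Σ-congAll : {A : Set} {xs : List A} {f g : A → ℚ} → All (λ x → f x ≡ g x) xs → Σ[ xs ] f ≡ Σ[ xs ] g
Σ-congAll []       = refl
Σ-congAll (p ∷ ps) = cong₂ ℚ._+_ p (Σ-congAll ps)

Σ-zero : {A : Set} (xs : List A) → Σ[ xs ] (λ _ → 0ℚ) ≡ 0ℚ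
Σ-zero []       = refl
Σ-zero (x ∷ xs) = cong (0ℚ ℚ.+_) (Σ-zero xs)

Σ-+ : {A : Set} (xs : List A) (f g : A → ℚ) → Σ[ xs ] (λ x → f x ℚ.+ g x) ≡ Σ[ xs ] f ℚ.+ Σ[ xs ] g
Σ-+ []       f g = refl
Σ-+ (x ∷ xs) f g = trans (cong (f x ℚ.+ g x ℚ.+_) (Σ-+ xs f g))
  (ℚ-+-interchange (f x) (g x) (Σ[ xs ] f) (Σ[ xs ] g))

guard : Bool → ℚ → ℚ
guard b q = if b then q else 0ℚ

Σ-filter : {A : Set} (P : A → Bool) (xs : List A) (f : A → ℚ) →
           Σ[ filter (λ p → T? (P p)) xs ] f ≡ Σ[ xs ] (λ p → guard (P p) (f p))
Σ-filter P []       f = refl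
Σ-filter P (x ∷ xs) f with P x
... | true  = cong (f x ℚ.+_) (Σ-filter P xs f)
... | false = trans (Σ-filter P xs f) (sym (ℚP.+-identityˡ _))

Σ-sublists-cons : ∀ x S (h : List ℕ → ℚ) → Σ[ sublists (x ∷ S) ] h ≡ Σ[ sublists S ] (h ∘ (x ∷_)) ℚ.+ Σ[ sublists S ] h
Σ-sublists-cons x S h = trans (Σ-++ (map (x ∷_) (sublists S)) (sublists S) h) (cong (ℚ._+ Σ[ sublists S ] h) (Σ-map (x ∷_) (sublists S) h))

pairSum : List ℕ → Series → Series → ℚ
pairSum S f g = Σ[ sublists S ] λ I → Σ[ sublists S ] λ J → guard (unionIs S (I , J)) (f I ℚ.* g J)

product-pairSum : ∀ S f g → (f · g) S ≡ pairSum S f g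
product-pairSum S f g = trans (Σ-filter (unionIs S) (concatMap (λ I → map (I ,_) (sublists S)) (sublists S)) _)
  (trans (Σ-concatMap (λ I → map (I ,_) (sublists S)) (sublists S) _)
    (Σ-cong (sublists S) (λ I → Σ-map (I ,_) (sublists S) _)))

sublists-All : {P : ℕ → Set} → ∀ {S} → All P S → All (All P) (sublists S)
sublists-All []                 = [] ∷ []
sublists-All {S = x ∷ S} (px ∷ ps) =
  AllP.++⁺ (AllP.map⁺ (All.map (px ∷_) (sublists-All ps))) (sublists-All ps)

sublists-increasing : ∀ {S} → AllPairs _<_ S → All (AllPairs _<_) (sublists S)
sublists-increasing []                 = [] ∷ []
sublists-increasing {S = x ∷ S} (px ∷ ps) =
  AllP.++⁺ (AllP.map⁺ (All.zipWith (λ { (a , b) → a ∷ b }) (sublists-All px , sublists-increasing ps)))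
           (sublists-increasing ps)

sublists-avoid : ∀ x {S} → All (x <_) S → All (λ I → elemᵇ x I ≡ false) (sublists S)
sublists-avoid x []            = refl ∷ []
sublists-avoid x {y ∷ S} (x<y ∷ S>x) = AllP.++⁺
  (AllP.map⁺ (All.map (λ e → cong₂ _∨_ (<⇒≢ᵇ x<y) e) (sublists-avoid x S>x))) (sublists-avoid x S>x)

module _ (x : ℕ) (S I J : List ℕ) (S>x : All (x <_) S) where

  private
    x∉ : ∀ K → All (λ s → (elemᵇ s (x ∷ K)) ≡ elemᵇ s K) S
    x∉ K = All.map (λ {s} x<s → cong (_∨ elemᵇ s K) (>⇒≢ᵇ x<s)) S>x

  union-both : unionIs (x ∷ S) (x ∷ I , x ∷ J) ≡ unionIs S (I , J)
  union-both rewrite ≡ᵇ-refl x = allᵇ-cong (All.zipWith (λ (eI , eJ) → cong₂ _∨_ eI eJ) (x∉ I , x∉ J))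

  union-left : unionIs (x ∷ S) (x ∷ I , J) ≡ unionIs S (I , J)
  union-left rewrite ≡ᵇ-refl x = allᵇ-cong (All.map (λ {s} → cong (_∨ elemᵇ s J)) (x∉ I))

  union-right : unionIs (x ∷ S) (I , x ∷ J) ≡ unionIs S (I , J)
  union-right rewrite ≡ᵇ-refl x | BoolP.∨-zeroʳ (elemᵇ x I) = allᵇ-cong (All.map (λ {s} → cong (elemᵇ s I ∨_)) (x∉ J))

  union-neither : elemᵇ x I ≡ false → elemᵇ x J ≡ false → unionIs (x ∷ S) (I , J) ≡ false
  union-neither x∉I x∉J rewrite x∉I | x∉J = refl

pairSum-cons : ∀ x S f g → All (x <_) S →
  pairSum (x ∷ S) f g ≡ pairSum S (f ∘ (x ∷_)) (g ∘ (x ∷_)) ℚ.+ pairSum S (f ∘ (x ∷_)) g ℚ.+ pairSum S f (g ∘ (x ∷_))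
pairSum-cons x S f g S>x = begin
  pairSum (x ∷ S) f g
    ≡⟨ Σ-sublists-cons x S row ⟩
  Σ[ R ] (row ∘ (x ∷_)) ℚ.+ Σ[ R ] row
    ≡⟨ cong₂ ℚ._+_ (Σ-cong R λ I → trans (Σ-sublists-cons x S (entry (x ∷ I))) (cong₂ ℚ._+_ (both I) (left I)))
                   (Σ-congAll (All.map (λ {I} x∉I → trans (Σ-sublists-cons x S (entry I)) (cong₂ ℚ._+_ (right I) (neither x∉I)))
                                        (sublists-avoid x S>x))) ⟩
  Σ[ R ] (λ I → Σ[ R ] (entry′ (f ∘ (x ∷_)) (g ∘ (x ∷_)) I) ℚ.+ Σ[ R ] (entry′ (f ∘ (x ∷_)) g I))
    ℚ.+ Σ[ R ] (λ I → Σ[ R ] (entry′ f (g ∘ (x ∷_)) I) ℚ.+ 0ℚ)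
    ≡⟨ cong₂ ℚ._+_ (Σ-+ R _ _) (Σ-cong R λ I → ℚP.+-identityʳ _) ⟩
  pairSum S (f ∘ (x ∷_)) (g ∘ (x ∷_)) ℚ.+ pairSum S (f ∘ (x ∷_)) g ℚ.+ pairSum S f (g ∘ (x ∷_)) ∎
  where
  open ≡-Reasoning
  R = sublists S
  entry : List ℕ → List ℕ → ℚ
  entry I J = guard (unionIs (x ∷ S) (I , J)) (f I ℚ.* g J)
  row : List ℕ → ℚ
  row I = Σ[ sublists (x ∷ S) ] (entry I)
  entry′ : Series → Series → List ℕ → List ℕ → ℚ
  entry′ f′ g′ I J = guard (unionIs S (I , J)) (f′ I ℚ.* g′ J)
  both : ∀ I → Σ[ R ] (entry (x ∷ I) ∘ (x ∷_)) ≡ Σ[ R ] (entry′ (f ∘ (x ∷_)) (g ∘ (x ∷_)) I)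
  both I = Σ-cong R λ J → cong (λ b → guard b _) (union-both x S I J S>x)
  left : ∀ I → Σ[ R ] (entry (x ∷ I)) ≡ Σ[ R ] (entry′ (f ∘ (x ∷_)) g I)
  left I = Σ-cong R λ J → cong (λ b → guard b _) (union-left x S I J S>x)
  right : ∀ I → Σ[ R ] (entry I ∘ (x ∷_)) ≡ Σ[ R ] (entry′ f (g ∘ (x ∷_)) I)
  right I = Σ-cong R λ J → cong (λ b → guard b _) (union-right x S I J S>x)
  neither : ∀ {I} → elemᵇ x I ≡ false → Σ[ R ] (entry I) ≡ 0ℚ
  neither {I} x∉I = trans (Σ-congAll (All.map (λ {J} x∉J → cong (λ b → guard b _) (union-neither x S I J S>x x∉I x∉J))
                                              (sublists-avoid x S>x)))
                          (Σ-zero R)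

-- Product of coefficient sequences of series whose coefficients only depend
-- on the cardinality of the support, following pairSum-cons.
_⊛_ : (ℕ → ℚ) → (ℕ → ℚ) → ℕ → ℚ
(f ⊛ g) zero    = f 0 ℚ.* g 0
(f ⊛ g) (suc s) = ((f ∘ suc) ⊛ (g ∘ suc)) s ℚ.+ ((f ∘ suc) ⊛ g) s ℚ.+ (f ⊛ (g ∘ suc)) s

pairSum-⊛ : ∀ S → AllPairs _<_ S → ∀ (f g : Series) (f̃ g̃ : ℕ → ℚ) →
            All (λ I → f I ≡ f̃ (length I)) (sublists S) → All (λ I → g I ≡ g̃ (length I)) (sublists S) →
            pairSum S f g ≡ (f̃ ⊛ g̃) (length S)
pairSum-⊛ []      _          f g f̃ g̃ (f∅ ∷ _) (g∅ ∷ _) =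
  trans (ℚP.+-identityʳ _) (trans (ℚP.+-identityʳ _) (cong₂ ℚ._*_ f∅ g∅))
pairSum-⊛ (x ∷ S) (S>x ∷ S↑) f g f̃ g̃ fI gI = trans (pairSum-cons x S f g S>x)
  (cong₂ ℚ._+_ (cong₂ ℚ._+_ (pairSum-⊛ S S↑ _ _ (f̃ ∘ suc) (g̃ ∘ suc) (withx fI) (withx gI))
                            (pairSum-⊛ S S↑ _ _ (f̃ ∘ suc) g̃ (withx fI) (withoutx gI)))
               (pairSum-⊛ S S↑ _ _ f̃ (g̃ ∘ suc) (withoutx fI) (withx gI)))
  where
  withx = λ {P : List ℕ → Set} (h : All P (map (x ∷_) (sublists S) ++ sublists S)) →
    AllP.map⁻ (AllP.++⁻ˡ (map (x ∷_) (sublists S)) h)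
  withoutx = λ {P : List ℕ → Set} (h : All P (map (x ∷_) (sublists S) ++ sublists S)) →
    AllP.++⁻ʳ (map (x ∷_) (sublists S)) h

Σ< : ℕ → (ℕ → ℚ) → ℚ
Σ< zero    f = 0ℚ
Σ< (suc L) f = f 0 ℚ.+ Σ< L (f ∘ suc)

Σ<-cong : ∀ L {f g : ℕ → ℚ} → (∀ k → k < L → f k ≡ g k) → Σ< L f ≡ Σ< L g
Σ<-cong zero    f≗g = refl
Σ<-cong (suc L) f≗g = cong₂ ℚ._+_ (f≗g 0 (s≤s z≤n)) (Σ<-cong L (λ k k<L → f≗g (suc k) (s≤s k<L)))

-- The binomial transform  (transform f)(s) = Σ_j C(s,j)·f(j), by Pascal's rule.
-- On coefficient sequences by cardinality it is the specialisation
-- x_1^0 = … = x_s^0 = 1, x_i^0 = 0 (i > s), hence multiplicative for ⊛ and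
-- injective.
transform : (ℕ → ℚ) → ℕ → ℚ
transform f zero    = f 0
transform f (suc s) = transform f s ℚ.+ transform (f ∘ suc) s

transform-cong : ∀ s {f g : ℕ → ℚ} → (∀ x → f x ≡ g x) → transform f s ≡ transform g s
transform-cong zero    f≗g = f≗g 0
transform-cong (suc s) f≗g = cong₂ ℚ._+_ (transform-cong s f≗g) (transform-cong s (f≗g ∘ suc))

transform-+ : ∀ s (f g : ℕ → ℚ) → transform (λ x → f x ℚ.+ g x) s ≡ transform f s ℚ.+ transform g s
transform-+ zero    f g = refl
transform-+ (suc s) f g = trans (cong₂ ℚ._+_ (transform-+ s f g) (transform-+ s (f ∘ suc) (g ∘ suc)))
  (ℚ-+-interchange (transform f s) (transform g s) (transform (f ∘ suc) s) (transform (g ∘ suc) s))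

transform-scale : ∀ s (c : ℚ) (f : ℕ → ℚ) → transform (λ x → c ℚ.* f x) s ≡ c ℚ.* transform f s
transform-scale zero    c f = refl
transform-scale (suc s) c f = trans (cong₂ ℚ._+_ (transform-scale s c f) (transform-scale s c (f ∘ suc)))
  (sym (ℚP.*-distribˡ-+ c (transform f s) (transform (f ∘ suc) s)))

transform-zero : ∀ s → transform (λ _ → 0ℚ) s ≡ 0ℚ
transform-zero zero    = refl
transform-zero (suc s) = cong₂ ℚ._+_ (transform-zero s) (transform-zero s)

transform-Σ< : ∀ L s (c : ℕ → ℚ) (F : ℕ → ℕ → ℚ) →
               transform (λ x → Σ< L (λ k → c k ℚ.* F k x)) s ≡ Σ< L (λ k → c k ℚ.* transform (F k) s)
transform-Σ< zero    s c F = transform-zero s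
transform-Σ< (suc L) s c F = trans (transform-+ s (λ x → c 0 ℚ.* F 0 x) (λ x → Σ< L (λ k → c (suc k) ℚ.* F (suc k) x)))
  (cong₂ ℚ._+_ (transform-scale s (c 0) (F 0)) (transform-Σ< L s (c ∘ suc) (F ∘ suc)))

transform-⊛ : ∀ s (f g : ℕ → ℚ) → transform (f ⊛ g) s ≡ transform f s ℚ.* transform g s
transform-⊛ zero    f g = refl
transform-⊛ (suc s) f g = begin
  transform (f ⊛ g) s ℚ.+ transform (λ x → ((f′ ⊛ g′) x ℚ.+ (f′ ⊛ g) x) ℚ.+ (f ⊛ g′) x) s
    ≡⟨ cong (transform (f ⊛ g) s ℚ.+_) (trans (transform-+ s _ (f ⊛ g′))
         (cong (ℚ._+ transform (f ⊛ g′) s) (transform-+ s (f′ ⊛ g′) (f′ ⊛ g)))) ⟩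
  transform (f ⊛ g) s ℚ.+ (transform (f′ ⊛ g′) s ℚ.+ transform (f′ ⊛ g) s ℚ.+ transform (f ⊛ g′) s)
    ≡⟨ cong₂ ℚ._+_ (transform-⊛ s f g) (cong₂ ℚ._+_ (cong₂ ℚ._+_ (transform-⊛ s f′ g′) (transform-⊛ s f′ g))
                                                        (transform-⊛ s f g′)) ⟩
  F ℚ.* G ℚ.+ (F′ ℚ.* G′ ℚ.+ F′ ℚ.* G ℚ.+ F ℚ.* G′)
    ≡⟨ expand F G F′ G′ ⟩
  (F ℚ.+ F′) ℚ.* (G ℚ.+ G′) ∎
  where
  open ≡-Reasoning
  f′ = f ∘ suc
  g′ = g ∘ suc
  F = transform f s
  G = transform g s
  F′ = transform f′ s
  G′ = transform g′ s
  expand : ∀ a b c d → a ℚ.* b ℚ.+ (c ℚ.* d ℚ.+ c ℚ.* b ℚ.+ a ℚ.* d) ≡ (a ℚ.+ c) ℚ.* (b ℚ.+ d)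
  expand = solve 4 (λ a b c d → a :* b :+ (c :* d :+ c :* b :+ a :* d) := (a :+ c) :* (b :+ d)) refl
    where open ℚSolver

transform-injective : ∀ s (f g : ℕ → ℚ) → (∀ t → transform f t ≡ transform g t) → f s ≡ g s
transform-injective zero    f g same = same 0
transform-injective (suc s) f g same = transform-injective s (f ∘ suc) (g ∘ suc)
  (λ t → ℚ-+-cancelˡ (transform f t) _ _ (trans (same (suc t)) (cong (ℚ._+ transform (g ∘ suc) t) (sym (same t)))))

-- kspec r s = Σ_j C(s,j)·mcoef r j is the specialisation of K_{0^r} at
-- s variables; it satisfies the Delannoy-type recursion below.
kspec : ℕ → ℕ → ℕ
kspec zero    s       = 1
kspec (suc r) zero    = 0
kspec (suc r) (suc s) = kspec (suc r) s + kspec r (suc s) + kspec r s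

mcoefℚ : ℕ → ℕ → ℚ
mcoefℚ r t = fromℕ (mcoef r t)

kspec-step : ∀ t → (∀ r → transform (mcoefℚ r) t ≡ fromℕ (kspec r t)) →
             ∀ r → transform (mcoefℚ r ∘ suc) t ℚ.+ fromℕ (kspec r t) ≡ fromℕ (kspec r (suc t))
kspec-step t hyp zero    = trans (cong (ℚ._+ fromℕ 1) (transform-zero t)) (ℚP.+-identityˡ _)
kspec-step t hyp (suc r) = begin
  transform (mcoefℚ (suc r) ∘ suc) t ℚ.+ fromℕ (kspec (suc r) t)
    ≡⟨ cong (ℚ._+ fromℕ (kspec (suc r) t)) shifted ⟩
  transform (mcoefℚ r ∘ suc) t ℚ.+ (fromℕ (kspec r t) ℚ.+ fromℕ (kspec r t)) ℚ.+ fromℕ (kspec (suc r) t)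
    ≡⟨ regroup (transform (mcoefℚ r ∘ suc) t) (fromℕ (kspec r t)) (fromℕ (kspec (suc r) t)) ⟩
  fromℕ (kspec (suc r) t) ℚ.+ (transform (mcoefℚ r ∘ suc) t ℚ.+ fromℕ (kspec r t)) ℚ.+ fromℕ (kspec r t)
    ≡⟨ cong (λ y → fromℕ (kspec (suc r) t) ℚ.+ y ℚ.+ fromℕ (kspec r t)) (kspec-step t hyp r) ⟩
  fromℕ (kspec (suc r) t) ℚ.+ fromℕ (kspec r (suc t)) ℚ.+ fromℕ (kspec r t)
    ≡⟨ sym (trans (fromℕ-+ (kspec (suc r) t + kspec r (suc t)) (kspec r t))
                  (cong (ℚ._+ fromℕ (kspec r t)) (fromℕ-+ (kspec (suc r) t) (kspec r (suc t))))) ⟩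
  fromℕ (kspec (suc r) (suc t)) ∎
  where
  open ≡-Reasoning
  regroup : ∀ z d e → z ℚ.+ (d ℚ.+ d) ℚ.+ e ≡ e ℚ.+ (z ℚ.+ d) ℚ.+ d
  regroup = solve 3 (λ z d e → z :+ (d :+ d) :+ e := e :+ (z :+ d) :+ d) refl
    where open ℚSolver
  shifted : transform (mcoefℚ (suc r) ∘ suc) t
            ≡ transform (mcoefℚ r ∘ suc) t ℚ.+ (fromℕ (kspec r t) ℚ.+ fromℕ (kspec r t))
  shifted = begin
    transform (mcoefℚ (suc r) ∘ suc) t
      ≡⟨ transform-cong t (λ x → trans (fromℕ-+ (mcoef r (suc x)) (2 * mcoef r x))
                                   (cong (mcoefℚ r (suc x) ℚ.+_) (double (mcoef r x)))) ⟩
    transform (λ x → mcoefℚ r (suc x) ℚ.+ (mcoefℚ r x ℚ.+ mcoefℚ r x)) t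
      ≡⟨ trans (transform-+ t (mcoefℚ r ∘ suc) _)
               (cong (transform (mcoefℚ r ∘ suc) t ℚ.+_) (transform-+ t (mcoefℚ r) (mcoefℚ r))) ⟩
    transform (mcoefℚ r ∘ suc) t ℚ.+ (transform (mcoefℚ r) t ℚ.+ transform (mcoefℚ r) t)
      ≡⟨ cong (λ y → transform (mcoefℚ r ∘ suc) t ℚ.+ (y ℚ.+ y)) (hyp r) ⟩
    transform (mcoefℚ r ∘ suc) t ℚ.+ (fromℕ (kspec r t) ℚ.+ fromℕ (kspec r t)) ∎
    where
    double : ∀ y → fromℕ (2 * y) ≡ fromℕ y ℚ.+ fromℕ y
    double y = trans (fromℕ-+ y (y + 0)) (cong (λ w → fromℕ y ℚ.+ fromℕ w) (ℕP.+-identityʳ y))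

transform-mcoef : ∀ t r → transform (mcoefℚ r) t ≡ fromℕ (kspec r t)
transform-mcoef zero    zero    = refl
transform-mcoef zero    (suc r) = refl
transform-mcoef (suc t) r = trans (cong (ℚ._+ transform (mcoefℚ r ∘ suc) t) (transform-mcoef t r))
  (trans (ℚP.+-comm (fromℕ (kspec r t)) _) (kspec-step t (transform-mcoef t) r))

-- With  binProd m n k = C(m+n-k,m)·C(m,k)
-- and  binProd⁻ m n k = binProd (m-1) (n-1) (k-1)  (0 if m, n or k is 0),
--     coef m n k = (-1)^k · (binProd m n k - binProd⁻ m n k),
-- which by absorption equals the statement's (-1)^k C(m+n-k,m) C(m,k) (m+n-2k)/(m+n-k).

binProd : ℕ → ℕ → ℕ → ℕ
binProd m n k = bin (m + n ∸ k) m * bin m k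

binProd⁻ : ℕ → ℕ → ℕ → ℕ
binProd⁻ _       _       zero    = 0
binProd⁻ zero    _       (suc k) = 0
binProd⁻ (suc m) zero    (suc k) = 0
binProd⁻ (suc m) (suc n) (suc k) = binProd m n k

binProd-vanish : ∀ m n k → m < k → binProd m n k ≡ 0
binProd-vanish m n k m<k = trans (cong (bin (m + n ∸ k) m *_) (bin-above m k m<k)) (ℕP.*-zeroʳ (bin (m + n ∸ k) m))

binProd⁻-vanish : ∀ m n k → m < k → binProd⁻ m n k ≡ 0
binProd⁻-vanish zero    n       (suc k) _         = refl
binProd⁻-vanish (suc m) zero    (suc k) _         = refl
binProd⁻-vanish (suc m) (suc n) (suc k) (s≤s m<k) = binProd-vanish m n k m<k

binProd-vanish-n : ∀ m n k → n < k → binProd m n k ≡ 0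
binProd-vanish-n m n k n<k with m ℕP.<? k
... | yes m<k = binProd-vanish m n k m<k
... | no m≮k = cong (_* bin m k) (bin-above (m + n ∸ k) m (ℕP.<-≤-trans
  (subst (_< m ∸ k + k) (sym (ℕP.+-∸-comm n k≤m)) (ℕP.+-monoʳ-< (m ∸ k) n<k)) (ℕP.≤-reflexive (ℕP.m∸n+n≡m k≤m))))
  where k≤m = ℕP.≮⇒≥ m≮k

binProd⁻-vanish-n : ∀ m n k → n < k → binProd⁻ m n k ≡ 0
binProd⁻-vanish-n zero    n       (suc k) _         = refl
binProd⁻-vanish-n (suc m) zero    (suc k) _         = refl
binProd⁻-vanish-n (suc m) (suc n) (suc k) (s≤s n<k) = binProd-vanish-n m n k n<k

binProd-m0-zero : ∀ m → binProd m 0 0 ≡ 1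
binProd-m0-zero m rewrite ℕP.+-identityʳ m = trans (ℕP.*-identityʳ _) (bin-diagonal m)

binProd-m0-suc : ∀ m k → binProd m 0 (suc k) ≡ 0
binProd-m0-suc m k = binProd-vanish-n m 0 (suc k) (s≤s z≤n)

binProd-diagonal : ∀ j → binProd j j j ≡ 1
binProd-diagonal j = cong₂ _*_ (trans (cong (λ x → bin x j) (ℕP.m+n∸n≡m j j)) (bin-diagonal j)) (bin-diagonal j)

binProd-pascal : ∀ m n k → binProd (suc m) (suc n) k ≡ binProd m (suc n) k + binProd (suc m) n k + binProd⁻ (suc m) (suc n) k
binProd-pascal m n zero = begin
  bin (suc m + suc n) (suc m) * 1                 ≡⟨ ℕP.*-identityʳ _ ⟩
  bin (m + suc n) m + bin (m + suc n) (suc m)     ≡⟨ cong₂ _+_ (sym (ℕP.*-identityʳ _))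
                                                       (trans (cong (λ x → bin x (suc m)) (ℕP.+-suc m n)) (sym (ℕP.*-identityʳ _))) ⟩
  bin (m + suc n) m * 1 + bin (suc m + n) (suc m) * 1 ≡⟨ sym (ℕP.+-identityʳ _) ⟩
  bin (m + suc n) m * 1 + bin (suc m + n) (suc m) * 1 + 0 ∎
  where open ≡-Reasoning
binProd-pascal m n (suc j) with j ≤? m
... | no j≰m = trans (binProd-vanish (suc m) (suc n) (suc j) (s≤s m<j))
  (sym (trans (cong₂ (λ x y → x + y + binProd m n j)
                     (binProd-vanish m (suc n) (suc j) (ℕP.m<n⇒m<1+n m<j)) (binProd-vanish (suc m) n (suc j) (s≤s m<j)))
              (binProd-vanish m n j m<j)))
  where m<j = ℕP.≰⇒> j≰m
... | yes j≤m = begin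
  bin (m + suc n ∸ j) (suc m) * bin (suc m) (suc j)  ≡⟨ cong (λ x → bin x (suc m) * bin (suc m) (suc j)) N+1 ⟩
  (bin N m + bin N (suc m)) * (bin m j + bin m (suc j)) ≡⟨ expand (bin N m) (bin N (suc m)) (bin m j) (bin m (suc j)) ⟩
  bin N m * bin m (suc j) + bin N (suc m) * (bin m j + bin m (suc j)) + bin N m * bin m j
    ≡⟨ cong (λ x → bin x m * bin m (suc j) + bin N (suc m) * (bin m j + bin m (suc j)) + bin N m * bin m j)
            (sym (cong (_∸ suc j) (ℕP.+-suc m n))) ⟩
  bin (m + suc n ∸ suc j) m * bin m (suc j) + bin N (suc m) * (bin m j + bin m (suc j)) + bin N m * bin m j ∎
  where
  open ≡-Reasoning
  N = m + n ∸ j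
  N+1 : m + suc n ∸ j ≡ suc N
  N+1 = trans (cong (_∸ j) (ℕP.+-suc m n)) (ℕP.+-∸-assoc 1 (ℕP.≤-trans j≤m (ℕP.m≤m+n m n)))
  expand : ∀ a b c d → (a + b) * (c + d) ≡ a * d + b * (c + d) + a * c
  expand = ℕSolver.solve-∀

binProd-pascal⁻ : ∀ m n j → 0 < m + n + j →
                  binProd m n j ≡ binProd⁻ (suc m) n (suc j) + binProd⁻ m (suc n) (suc j) + binProd⁻ m n j
binProd-pascal⁻ zero    zero    (suc j) _ = refl
binProd-pascal⁻ zero    (suc n) zero    _ = refl
binProd-pascal⁻ zero    (suc n) (suc j) _ = refl
binProd-pascal⁻ (suc m) zero    zero    _ = trans (binProd-m0-zero (suc m)) (sym (trans (ℕP.+-identityʳ _) (binProd-m0-zero m)))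
binProd-pascal⁻ (suc m) zero    (suc j) _ = trans (binProd-m0-suc (suc m) j) (sym (trans (ℕP.+-identityʳ _) (binProd-m0-suc m j)))
binProd-pascal⁻ (suc m) (suc n) j       _ = trans (binProd-pascal m n j)
  (cong (_+ binProd⁻ (suc m) (suc n) j) (ℕP.+-comm (binProd m (suc n) j) (binProd (suc m) n j)))

binProd-absorb : ∀ m n k → binProd⁻ m n k * (m + n ∸ k) ≡ binProd m n k * k
binProd-absorb m       n       zero    = sym (ℕP.*-zeroʳ (binProd m n 0))
binProd-absorb zero    n       (suc k) = refl
binProd-absorb (suc m) zero    (suc k) = sym (cong (_* suc k) (binProd-m0-suc (suc m) k))
binProd-absorb (suc m) (suc n) (suc j) with j ≤? m + n
... | no j≰ = trans (cong (_* (m + suc n ∸ j)) (binProd-vanish m n j m<j))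
                    (sym (cong (_* suc j) (binProd-vanish (suc m) (suc n) (suc j) (s≤s m<j))))
  where m<j = ℕP.≤-trans (s≤s (ℕP.m≤m+n m n)) (ℕP.≰⇒> j≰)
... | yes j≤ = begin
  bin N m * bin m j * (m + suc n ∸ j)                 ≡⟨ cong (bin N m * bin m j *_) N+1 ⟩
  bin N m * bin m j * suc N                           ≡⟨ swap (bin N m) (bin m j) (suc N) ⟩
  (suc N * bin N m) * bin m j                         ≡⟨ cong (_* bin m j) (sym (bin-absorb N m)) ⟩
  (bin (suc N) (suc m) * suc m) * bin m j             ≡⟨ ℕP.*-assoc (bin (suc N) (suc m)) (suc m) (bin m j) ⟩
  bin (suc N) (suc m) * (suc m * bin m j)             ≡⟨ cong (bin (suc N) (suc m) *_) (sym (bin-absorb m j)) ⟩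
  bin (suc N) (suc m) * (bin (suc m) (suc j) * suc j) ≡⟨ sym (ℕP.*-assoc (bin (suc N) (suc m)) (bin (suc m) (suc j)) (suc j)) ⟩
  bin (suc N) (suc m) * bin (suc m) (suc j) * suc j   ≡⟨ cong (λ x → bin x (suc m) * bin (suc m) (suc j) * suc j) (sym N+1) ⟩
  binProd (suc m) (suc n) (suc j) * suc j             ∎
  where
  open ≡-Reasoning
  N = m + n ∸ j
  N+1 : m + suc n ∸ j ≡ suc N
  N+1 = trans (cong (_∸ j) (ℕP.+-suc m n)) (ℕP.+-∸-assoc 1 j≤)
  swap : ∀ a b c → a * b * c ≡ (c * a) * b
  swap = ℕSolver.solve-∀

sign : ℕ → ℤ
sign k = (ℤ.- + 1) ℤ.^ k

coef : ℕ → ℕ → ℕ → ℤ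
coef m n k = sign k ℤ.* (+ binProd m n k ℤ.- + binProd⁻ m n k)

coef⁻ : ℕ → ℕ → ℕ → ℤ
coef⁻ m n zero    = + 0
coef⁻ m n (suc k) = coef m n k

coef-vanish : ∀ m n k → m < k ⊎ n < k → coef m n k ≡ + 0
coef-vanish m n k (inj₁ m<k) rewrite binProd-vanish m n k m<k | binProd⁻-vanish m n k m<k = ℤP.*-zeroʳ (sign k)
coef-vanish m n k (inj₂ n<k) rewrite binProd-vanish-n m n k n<k | binProd⁻-vanish-n m n k n<k = ℤP.*-zeroʳ (sign k)

+-three : ∀ a b c → + (a + b + c) ≡ + a ℤ.+ + b ℤ.+ + c
+-three a b c = trans (ℤP.pos-+ (a + b) c) (cong (ℤ._+ + c) (ℤP.pos-+ a b))

coef-pascal : ∀ m n k → k + k ≤ suc (m + n) →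
              coef m (suc n) k ℤ.+ coef (suc m) n k ≡ coef (suc m) (suc n) k ℤ.+ coef⁻ m n k
coef-pascal m n zero _ rewrite binProd-pascal m n zero | +-three (binProd m (suc n) 0) (binProd (suc m) n 0) 0 =
  identity (+ binProd m (suc n) 0) (+ binProd (suc m) n 0)
  where
  identity : ∀ a b → + 1 ℤ.* (a ℤ.- + 0) ℤ.+ + 1 ℤ.* (b ℤ.- + 0) ≡ + 1 ℤ.* ((a ℤ.+ b ℤ.+ + 0) ℤ.- + 0) ℤ.+ + 0
  identity = ℤSolver.solve-∀
coef-pascal m n (suc j) (s≤s 2k≤) = expanded
  where
  a = binProd m (suc n) (suc j)
  b = binProd⁻ m (suc n) (suc j)
  c = binProd (suc m) n (suc j)
  d = binProd⁻ (suc m) n (suc j)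
  g = binProd⁻ m n j
  nonzero : 0 < m + n + j
  nonzero = ℕP.≤-trans (ℕP.≤-trans (s≤s z≤n) (ℕP.≤-trans (ℕP.≤-reflexive (sym (ℕP.+-suc j j))) 2k≤))
                       (ℕP.m≤m+n (m + n) j)
  identity : ∀ σ a b c d g →
    (ℤ.- + 1 ℤ.* σ) ℤ.* (a ℤ.- b) ℤ.+ (ℤ.- + 1 ℤ.* σ) ℤ.* (c ℤ.- d)
    ≡ (ℤ.- + 1 ℤ.* σ) ℤ.* ((a ℤ.+ c ℤ.+ (d ℤ.+ b ℤ.+ g)) ℤ.- (d ℤ.+ b ℤ.+ g)) ℤ.+ σ ℤ.* ((d ℤ.+ b ℤ.+ g) ℤ.- g)
  identity = ℤSolver.solve-∀
  expanded : coef m (suc n) (suc j) ℤ.+ coef (suc m) n (suc j) ≡ coef (suc m) (suc n) (suc j) ℤ.+ coef⁻ m n (suc j)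
  expanded rewrite binProd-pascal m n (suc j) | binProd-pascal⁻ m n j nonzero
                 | +-three a c (d + b + g) | +-three d b g = identity (sign j) (+ a) (+ b) (+ c) (+ d) (+ g)

coef-diagonal : ∀ j → coef (suc j) (suc j) (suc j) ≡ + 0
coef-diagonal j rewrite binProd-diagonal j | binProd-diagonal (suc j) = ℤP.*-zeroʳ (sign (suc j))

-- kspec extended by 0 to negative first index; the recursion then holds at
-- every integer index.
kspecℤ : ℤ → ℕ → ℤ
kspecℤ (+ j)    s = + kspec j s
kspecℤ -[1+ _ ] s = + 0

kspecℤ-rec : ∀ j s → kspecℤ j (suc s) ≡ kspecℤ (j ℤ.- + 1) (suc s) ℤ.+ kspecℤ j s ℤ.+ kspecℤ (j ℤ.- + 1) s
kspecℤ-rec (+ zero)  s = refl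
kspecℤ-rec (+ suc r) s = trans (+-three (kspec (suc r) s) (kspec r (suc s)) (kspec r s))
  (swap (+ kspec (suc r) s) (+ kspec r (suc s)) (+ kspec r s))
  where
  swap : ∀ a b c → a ℤ.+ b ℤ.+ c ≡ b ℤ.+ a ℤ.+ c
  swap = ℤSolver.solve-∀
kspecℤ-rec -[1+ r ]  s = refl

kspecℤ-≥ : ∀ {a b} t → b ≤ a → kspecℤ (+ a ℤ.- + b) t ≡ + kspec (a ∸ b) t
kspecℤ-≥ {a} {b} t b≤a rewrite ℤP.[+m]-[+n]≡m⊖n a b | ℤP.⊖-≥ b≤a = refl

kspecℤ-< : ∀ {a b} t → a < b → kspecℤ (+ a ℤ.- + b) t ≡ + 0
kspecℤ-< {a} {suc b} t (s≤s a≤b) rewrite ℤP.[+m]-[+n]≡m⊖n a (suc b) | ℤP.⊖-< (s≤s a≤b) | ℕP.+-∸-assoc 1 a≤b = refl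

Σℤ< : ℕ → (ℕ → ℤ) → ℤ
Σℤ< zero    f = + 0
Σℤ< (suc L) f = f 0 ℤ.+ Σℤ< L (f ∘ suc)

Σℤ<-cong : ∀ L {f g : ℕ → ℤ} → (∀ k → f k ≡ g k) → Σℤ< L f ≡ Σℤ< L g
Σℤ<-cong zero    f≗g = refl
Σℤ<-cong (suc L) f≗g = cong₂ ℤ._+_ (f≗g 0) (Σℤ<-cong L (f≗g ∘ suc))

Σℤ<-zero : ∀ L (f : ℕ → ℤ) → (∀ k → f k ≡ + 0) → Σℤ< L f ≡ + 0
Σℤ<-zero zero    f f≗0 = refl
Σℤ<-zero (suc L) f f≗0 = cong₂ ℤ._+_ (f≗0 0) (Σℤ<-zero L (f ∘ suc) (f≗0 ∘ suc))

Σℤ<-drop-last : ∀ L (f : ℕ → ℤ) → f L ≡ + 0 → Σℤ< (suc L) f ≡ Σℤ< L f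
Σℤ<-drop-last zero    f f0≡0 = trans (ℤP.+-identityʳ (f 0)) f0≡0
Σℤ<-drop-last (suc L) f fL≡0 = cong (λ x → f 0 ℤ.+ x) (Σℤ<-drop-last L (f ∘ suc) fL≡0)

Σℤ<-relation : ∀ L (a b c d e f g h : ℕ → ℤ) →
  (∀ k → a k ℤ.+ b k ≡ c k ℤ.+ d k ℤ.+ (e k ℤ.+ f k ℤ.+ g k ℤ.+ h k)) →
  Σℤ< L a ℤ.+ Σℤ< L b ≡ Σℤ< L c ℤ.+ Σℤ< L d ℤ.+ (Σℤ< L e ℤ.+ Σℤ< L f ℤ.+ Σℤ< L g ℤ.+ Σℤ< L h)
Σℤ<-relation zero    a b c d e f g h rel = refl
Σℤ<-relation (suc L) a b c d e f g h rel =
  trans (regroup (a 0) (b 0) (Σℤ< L (a ∘ suc)) (Σℤ< L (b ∘ suc)))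
  (trans (cong₂ ℤ._+_ (rel 0)
                      (Σℤ<-relation L (a ∘ suc) (b ∘ suc) (c ∘ suc) (d ∘ suc) (e ∘ suc) (f ∘ suc) (g ∘ suc) (h ∘ suc) (rel ∘ suc)))
         (spread (c 0) (d 0) (e 0) (f 0) (g 0) (h 0) (Σℤ< L (c ∘ suc)) (Σℤ< L (d ∘ suc)) (Σℤ< L (e ∘ suc))
                 (Σℤ< L (f ∘ suc)) (Σℤ< L (g ∘ suc)) (Σℤ< L (h ∘ suc))))
  where
  regroup : ∀ a b A B → (a ℤ.+ A) ℤ.+ (b ℤ.+ B) ≡ (a ℤ.+ b) ℤ.+ (A ℤ.+ B)
  regroup = ℤSolver.solve-∀
  spread : ∀ c d e f g h C D E F G H →
    (c ℤ.+ d ℤ.+ (e ℤ.+ f ℤ.+ g ℤ.+ h)) ℤ.+ (C ℤ.+ D ℤ.+ (E ℤ.+ F ℤ.+ G ℤ.+ H))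
    ≡ (c ℤ.+ C) ℤ.+ (d ℤ.+ D) ℤ.+ ((e ℤ.+ E) ℤ.+ (f ℤ.+ F) ℤ.+ (g ℤ.+ G) ℤ.+ (h ℤ.+ H))
  spread = ℤSolver.solve-∀

index : ℕ → ℕ → ℕ → ℤ
index m n k = + (m + n) ℤ.- + (k + k)

term : ℕ → ℕ → ℕ → ℕ → ℤ
term s m n k = coef m n k ℤ.* kspecℤ (index m n k) s

lhs : ℕ → ℕ → ℕ → ℤ
lhs s m n = + (kspec m s * kspec n s)

rhs : ℕ → ℕ → ℕ → ℤ
rhs s m n = Σℤ< (suc m) (term s m n)

Recurrent : (ℕ → ℕ → ℕ → ℤ) → Set
Recurrent X = ∀ s m n →
  X (suc s) (suc m) (suc n) ℤ.+ X (suc s) m n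
  ≡ X (suc s) m (suc n) ℤ.+ X (suc s) (suc m) n ℤ.+ (X s (suc m) (suc n) ℤ.+ X s m n ℤ.+ X s m (suc n) ℤ.+ X s (suc m) n)

recurrent-unique : ∀ X Y → Recurrent X → Recurrent Y →
  (∀ m n → X 0 m n ≡ Y 0 m n) → (∀ s n → X s 0 n ≡ Y s 0 n) → (∀ s m → X s m 0 ≡ Y s m 0) →
  ∀ s m n → X s m n ≡ Y s m n
recurrent-unique X Y recX recY base left right = go
  where
  go : ∀ s m n → X s m n ≡ Y s m n
  go zero    m       n       = base m n
  go (suc s) zero    n       = left (suc s) n
  go (suc s) (suc m) zero    = right (suc s) (suc m)
  go (suc s) (suc m) (suc n) = ℤ-+-cancelʳ (X (suc s) m n) (X (suc s) (suc m) (suc n)) (Y (suc s) (suc m) (suc n)) (begin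
    X (suc s) (suc m) (suc n) ℤ.+ X (suc s) m n
      ≡⟨ recX s m n ⟩
    X (suc s) m (suc n) ℤ.+ X (suc s) (suc m) n ℤ.+ (X s (suc m) (suc n) ℤ.+ X s m n ℤ.+ X s m (suc n) ℤ.+ X s (suc m) n)
      ≡⟨ cong₂ ℤ._+_ (cong₂ ℤ._+_ (go (suc s) m (suc n)) (go (suc s) (suc m) n))
                     (cong₂ ℤ._+_ (cong₂ ℤ._+_ (cong₂ ℤ._+_ (go s (suc m) (suc n)) (go s m n)) (go s m (suc n))) (go s (suc m) n)) ⟩
    Y (suc s) m (suc n) ℤ.+ Y (suc s) (suc m) n ℤ.+ (Y s (suc m) (suc n) ℤ.+ Y s m n ℤ.+ Y s m (suc n) ℤ.+ Y s (suc m) n)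
      ≡⟨ sym (recY s m n) ⟩
    Y (suc s) (suc m) (suc n) ℤ.+ Y (suc s) m n
      ≡⟨ cong (λ x → Y (suc s) (suc m) (suc n) ℤ.+ x) (sym (go (suc s) m n)) ⟩
    Y (suc s) (suc m) (suc n) ℤ.+ X (suc s) m n ∎)
    where open ≡-Reasoning

lhs-recurrent : Recurrent lhs
lhs-recurrent s m n = begin
  + (K m′ s′ * K n′ s′) ℤ.+ + (K m s′ * K n s′)
    ≡⟨ sym (ℤP.pos-+ (K m′ s′ * K n′ s′) (K m s′ * K n s′)) ⟩
  + ((p₁ + u + p) * (q₁ + v + q) + u * v)
    ≡⟨ cong +_ (expand p p₁ q q₁ u v) ⟩
  + (u * K n′ s′ + K m′ s′ * v + (p₁ * q₁ + p * q + p * q₁ + p₁ * q))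
    ≡⟨ ℤP.pos-+ (u * K n′ s′ + K m′ s′ * v) _ ⟩
  + (u * K n′ s′ + K m′ s′ * v) ℤ.+ + (p₁ * q₁ + p * q + p * q₁ + p₁ * q)
    ≡⟨ cong₂ ℤ._+_ (ℤP.pos-+ (u * K n′ s′) (K m′ s′ * v))
                   (trans (+-three (p₁ * q₁ + p * q) (p * q₁) (p₁ * q))
                          (cong (λ x → x ℤ.+ + (p * q₁) ℤ.+ + (p₁ * q)) (ℤP.pos-+ (p₁ * q₁) (p * q)))) ⟩
  lhs s′ m n′ ℤ.+ lhs s′ m′ n ℤ.+ (lhs s m′ n′ ℤ.+ lhs s m n ℤ.+ lhs s m n′ ℤ.+ lhs s m′ n) ∎
  where
  open ≡-Reasoning
  K = kspec
  m′ = suc m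
  n′ = suc n
  s′ = suc s
  p = K m s
  p₁ = K m′ s
  q = K n s
  q₁ = K n′ s
  u = K m s′
  v = K n s′
  expand : ∀ p p₁ q q₁ u v → (p₁ + u + p) * (q₁ + v + q) + u * v
           ≡ u * (q₁ + v + q) + (p₁ + u + p) * v + (p₁ * q₁ + p * q + p * q₁ + p₁ * q)
  expand = ℕSolver.solve-∀

index-shiftˡ : ∀ m n k → index m (suc n) k ≡ index (suc m) (suc n) k ℤ.- + 1
index-shiftˡ m n k = shift (+ m) (+ n) (+ k)
  where
  shift : ∀ M N K → M ℤ.+ (+ 1 ℤ.+ N) ℤ.- (K ℤ.+ K) ≡ (+ 1 ℤ.+ M ℤ.+ (+ 1 ℤ.+ N) ℤ.- (K ℤ.+ K)) ℤ.- + 1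
  shift = ℤSolver.solve-∀

index-shiftʳ : ∀ m n k → index (suc m) n k ≡ index (suc m) (suc n) k ℤ.- + 1
index-shiftʳ m n k = shift (+ m) (+ n) (+ k)
  where
  shift : ∀ M N K → + 1 ℤ.+ M ℤ.+ N ℤ.- (K ℤ.+ K) ≡ (+ 1 ℤ.+ M ℤ.+ (+ 1 ℤ.+ N) ℤ.- (K ℤ.+ K)) ℤ.- + 1
  shift = ℤSolver.solve-∀

index-diagonal : ∀ m n k → index (suc m) (suc n) (suc k) ≡ index m n k
index-diagonal m n k = shift (+ m) (+ n) (+ k)
  where
  shift : ∀ M N K → + 1 ℤ.+ M ℤ.+ (+ 1 ℤ.+ N) ℤ.- (+ 1 ℤ.+ K ℤ.+ (+ 1 ℤ.+ K)) ≡ M ℤ.+ N ℤ.- (K ℤ.+ K)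
  shift = ℤSolver.solve-∀

index-pred : ∀ m n k → index (suc m) (suc n) k ℤ.- + 1 ≡ + suc (m + n) ℤ.- + (k + k)
index-pred m n k = shift (+ m) (+ n) (+ k)
  where
  shift : ∀ M N K → (+ 1 ℤ.+ M ℤ.+ (+ 1 ℤ.+ N) ℤ.- (K ℤ.+ K)) ℤ.- + 1 ≡ + 1 ℤ.+ (M ℤ.+ N) ℤ.- (K ℤ.+ K)
  shift = ℤSolver.solve-∀

-- Multiplying a recursion U = U′ + V + V′ by c₁ + c₄ and trading c₁ + c₄ for
-- c₂ + c₃ on U′ and V′; the trade is free when U′ and V′ vanish.
trade-coefficients : ∀ c₁ c₂ c₃ c₄ U U′ V V′ →
  c₂ ℤ.+ c₃ ≡ c₁ ℤ.+ c₄ ⊎ (U′ ≡ + 0 × V′ ≡ + 0) → U ≡ U′ ℤ.+ V ℤ.+ V′ →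
  c₁ ℤ.* U ℤ.+ c₄ ℤ.* U
  ≡ c₂ ℤ.* U′ ℤ.+ c₃ ℤ.* U′ ℤ.+ (c₁ ℤ.* V ℤ.+ c₄ ℤ.* V ℤ.+ c₂ ℤ.* V′ ℤ.+ c₃ ℤ.* V′)
trade-coefficients c₁ c₂ c₃ c₄ _ U′ V V′ (inj₁ same) refl = begin
  c₁ ℤ.* (U′ ℤ.+ V ℤ.+ V′) ℤ.+ c₄ ℤ.* (U′ ℤ.+ V ℤ.+ V′)
    ≡⟨ collect c₁ c₄ U′ V V′ ⟩
  (c₁ ℤ.+ c₄) ℤ.* U′ ℤ.+ (c₁ ℤ.* V ℤ.+ c₄ ℤ.* V) ℤ.+ (c₁ ℤ.+ c₄) ℤ.* V′
    ≡⟨ cong (λ c → c ℤ.* U′ ℤ.+ (c₁ ℤ.* V ℤ.+ c₄ ℤ.* V) ℤ.+ c ℤ.* V′) (sym same) ⟩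
  (c₂ ℤ.+ c₃) ℤ.* U′ ℤ.+ (c₁ ℤ.* V ℤ.+ c₄ ℤ.* V) ℤ.+ (c₂ ℤ.+ c₃) ℤ.* V′
    ≡⟨ spread c₁ c₂ c₃ c₄ U′ V V′ ⟩
  c₂ ℤ.* U′ ℤ.+ c₃ ℤ.* U′ ℤ.+ (c₁ ℤ.* V ℤ.+ c₄ ℤ.* V ℤ.+ c₂ ℤ.* V′ ℤ.+ c₃ ℤ.* V′) ∎
  where
  open ≡-Reasoning
  collect : ∀ a d U′ V V′ → a ℤ.* (U′ ℤ.+ V ℤ.+ V′) ℤ.+ d ℤ.* (U′ ℤ.+ V ℤ.+ V′)
            ≡ (a ℤ.+ d) ℤ.* U′ ℤ.+ (a ℤ.* V ℤ.+ d ℤ.* V) ℤ.+ (a ℤ.+ d) ℤ.* V′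
  collect = ℤSolver.solve-∀
  spread : ∀ a b c d U′ V V′ → (b ℤ.+ c) ℤ.* U′ ℤ.+ (a ℤ.* V ℤ.+ d ℤ.* V) ℤ.+ (b ℤ.+ c) ℤ.* V′
           ≡ b ℤ.* U′ ℤ.+ c ℤ.* U′ ℤ.+ (a ℤ.* V ℤ.+ d ℤ.* V ℤ.+ b ℤ.* V′ ℤ.+ c ℤ.* V′)
  spread = ℤSolver.solve-∀
trade-coefficients c₁ c₂ c₃ c₄ _ _ V _ (inj₂ (refl , refl)) refl = identity c₁ c₂ c₃ c₄ V
  where
  identity : ∀ a b c d V → a ℤ.* (+ 0 ℤ.+ V ℤ.+ + 0) ℤ.+ d ℤ.* (+ 0 ℤ.+ V ℤ.+ + 0)
             ≡ b ℤ.* + 0 ℤ.+ c ℤ.* + 0 ℤ.+ (a ℤ.* V ℤ.+ d ℤ.* V ℤ.+ b ℤ.* + 0 ℤ.+ c ℤ.* + 0)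
  identity = ℤSolver.solve-∀

-- The recurrence termwise: combine Pascal's rule for the coefficients with the
-- recursion of kspec at index m+n+2-2k.
term-relation : ∀ s m n k →
  term (suc s) (suc m) (suc n) k ℤ.+ coef⁻ m n k ℤ.* kspecℤ (index (suc m) (suc n) k) (suc s)
  ≡ term (suc s) m (suc n) k ℤ.+ term (suc s) (suc m) n k ℤ.+
    (term s (suc m) (suc n) k ℤ.+ coef⁻ m n k ℤ.* kspecℤ (index (suc m) (suc n) k) s ℤ.+ term s m (suc n) k ℤ.+ term s (suc m) n k)
term-relation s m n k rewrite index-shiftˡ m n k | index-shiftʳ m n k =
  trade-coefficients (coef (suc m) (suc n) k) (coef m (suc n) k) (coef (suc m) n k) (coef⁻ m n k)
    (kspecℤ J (suc s)) (kspecℤ (J ℤ.- + 1) (suc s)) (kspecℤ J s) (kspecℤ (J ℤ.- + 1) s) tradeable (kspecℤ-rec J s)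
  where
  J = index (suc m) (suc n) k
  tradeable : coef m (suc n) k ℤ.+ coef (suc m) n k ≡ coef (suc m) (suc n) k ℤ.+ coef⁻ m n k
              ⊎ (kspecℤ (J ℤ.- + 1) (suc s) ≡ + 0 × kspecℤ (J ℤ.- + 1) s ≡ + 0)
  tradeable with k + k ≤? suc (m + n)
  ... | yes 2k≤ = inj₁ (coef-pascal m n k 2k≤)
  ... | no 2k≰ = inj₂ (below (suc s) , below s)
    where
    below : ∀ t → kspecℤ (J ℤ.- + 1) t ≡ + 0
    below t = trans (cong (λ i → kspecℤ i t) (index-pred m n k)) (kspecℤ-< t (ℕP.≰⇒> 2k≰))

shifted-sum : ∀ s m n → Σℤ< (suc (suc m)) (λ k → coef⁻ m n k ℤ.* kspecℤ (index (suc m) (suc n) k) s) ≡ rhs s m n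
shifted-sum s m n = trans (ℤP.+-identityˡ _)
  (Σℤ<-cong (suc m) (λ k → cong (λ i → coef m n k ℤ.* kspecℤ i s) (index-diagonal m n k)))

extended-sum : ∀ s m n → Σℤ< (suc (suc m)) (term s m n) ≡ rhs s m n
extended-sum s m n = Σℤ<-drop-last (suc m) (term s m n)
  (cong (ℤ._* kspecℤ (index m n (suc m)) s) (coef-vanish m n (suc m) (inj₁ (ℕP.n<1+n m))))

rhs-recurrent : Recurrent rhs
rhs-recurrent s m n = begin
  rhs (suc s) (suc m) (suc n) ℤ.+ rhs (suc s) m n
    ≡⟨ cong (λ x → rhs (suc s) (suc m) (suc n) ℤ.+ x) (sym (shifted-sum (suc s) m n)) ⟩
  Σℤ< L (term (suc s) (suc m) (suc n)) ℤ.+ Σℤ< L (shifted (suc s))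
    ≡⟨ Σℤ<-relation L (term (suc s) (suc m) (suc n)) (shifted (suc s)) (term (suc s) m (suc n)) (term (suc s) (suc m) n)
                      (term s (suc m) (suc n)) (shifted s) (term s m (suc n)) (term s (suc m) n) (term-relation s m n) ⟩
  Σℤ< L (term (suc s) m (suc n)) ℤ.+ rhs (suc s) (suc m) n ℤ.+
    (rhs s (suc m) (suc n) ℤ.+ Σℤ< L (shifted s) ℤ.+ Σℤ< L (term s m (suc n)) ℤ.+ rhs s (suc m) n)
    ≡⟨ cong₂ (λ x y → x ℤ.+ rhs (suc s) (suc m) n ℤ.+ (rhs s (suc m) (suc n) ℤ.+ y ℤ.+ Σℤ< L (term s m (suc n)) ℤ.+ rhs s (suc m) n))
             (extended-sum (suc s) m (suc n)) (shifted-sum s m n) ⟩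
  rhs (suc s) m (suc n) ℤ.+ rhs (suc s) (suc m) n ℤ.+
    (rhs s (suc m) (suc n) ℤ.+ rhs s m n ℤ.+ Σℤ< L (term s m (suc n)) ℤ.+ rhs s (suc m) n)
    ≡⟨ cong (λ x → rhs (suc s) m (suc n) ℤ.+ rhs (suc s) (suc m) n ℤ.+ (rhs s (suc m) (suc n) ℤ.+ rhs s m n ℤ.+ x ℤ.+ rhs s (suc m) n))
            (extended-sum s m (suc n)) ⟩
  rhs (suc s) m (suc n) ℤ.+ rhs (suc s) (suc m) n ℤ.+ (rhs s (suc m) (suc n) ℤ.+ rhs s m n ℤ.+ rhs s m (suc n) ℤ.+ rhs s (suc m) n) ∎
  where
  open ≡-Reasoning
  L = suc (suc m)
  shifted : ℕ → ℕ → ℤ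
  shifted t k = coef⁻ m n k ℤ.* kspecℤ (index (suc m) (suc n) k) t

-- Boundary values: at m = 0 or n = 0 only the term k = 0 survives.
rhs-left : ∀ s n → rhs s 0 n ≡ + kspec n s
rhs-left s n = trans (ℤP.+-identityʳ _) (trans (ℤP.*-identityˡ _) (cong (λ j → + kspec j s) (ℕP.+-identityʳ n)))

rhs-right : ∀ s m → rhs s m 0 ≡ + kspec m s
rhs-right s m = begin
  term s m 0 0 ℤ.+ Σℤ< m (term s m 0 ∘ suc)
    ≡⟨ cong (λ x → term s m 0 0 ℤ.+ x) (Σℤ<-zero m _ (λ k →
         cong (ℤ._* kspecℤ (index m 0 (suc k)) s) (coef-vanish m 0 (suc k) (inj₂ (s≤s z≤n))))) ⟩
  term s m 0 0 ℤ.+ + 0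
    ≡⟨ ℤP.+-identityʳ _ ⟩
  + 1 ℤ.* (+ binProd m 0 0 ℤ.- + 0) ℤ.* kspecℤ (+ (m + 0) ℤ.- + 0) s
    ≡⟨ cong₂ (λ b j → + 1 ℤ.* (+ b ℤ.- + 0) ℤ.* kspecℤ (+ j ℤ.- + 0) s) (binProd-m0-zero m) (ℕP.+-identityʳ m) ⟩
  + 1 ℤ.* kspecℤ (+ m ℤ.- + 0) s
    ≡⟨ cong (λ i → + 1 ℤ.* kspecℤ i s) (ℤP.+-identityʳ (+ m)) ⟩
  + 1 ℤ.* + kspec m s
    ≡⟨ ℤP.*-identityˡ _ ⟩
  + kspec m s ∎
  where open ≡-Reasoning

squeeze : ∀ {a b k} → k ≤ a → k ≤ b → a + b ≡ k + k → b ≡ k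
squeeze {a} {b} {k} k≤a k≤b a+b≡2k = ℕP.≤-antisym
  (ℕP.+-cancelˡ-≤ k b k (ℕP.≤-trans (ℕP.+-monoˡ-≤ b k≤a) (ℕP.≤-reflexive a+b≡2k))) k≤b

-- The base case s = 0: kspec r 0 = [r = 0], so only terms with m+n = 2k
-- could contribute, and their coefficients vanish for m, n ≥ 1.
coef-balanced : ∀ m n k → suc m + suc n ≡ k + k → coef (suc m) (suc n) k ≡ + 0
coef-balanced m n k m+n≡2k with suc m <? k | suc n <? k
... | yes m<k | _       = coef-vanish (suc m) (suc n) k (inj₁ m<k)
... | no _    | yes n<k = coef-vanish (suc m) (suc n) k (inj₂ n<k)
... | no m≮k  | no n≮k
  with squeeze (ℕP.≮⇒≥ m≮k) (ℕP.≮⇒≥ n≮k) m+n≡2k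
     | squeeze (ℕP.≮⇒≥ n≮k) (ℕP.≮⇒≥ m≮k) (trans (ℕP.+-comm (suc n) (suc m)) m+n≡2k)
...   | refl | refl = coef-diagonal n

kspec-no-variables : ∀ r → 0 < r → kspec r 0 ≡ 0
kspec-no-variables (suc r) _ = refl

term-base : ∀ m n k → term 0 (suc m) (suc n) k ≡ + 0
term-base m n k with ℕP.<-cmp (suc m + suc n) (k + k)
... | tri< lt _ _ = trans (cong (coef (suc m) (suc n) k ℤ.*_) (kspecℤ-< 0 lt)) (ℤP.*-zeroʳ (coef (suc m) (suc n) k))
... | tri≈ _ eq _ = cong (ℤ._* kspecℤ (index (suc m) (suc n) k) 0) (coef-balanced m n k eq)
... | tri> _ _ gt = trans (cong (coef (suc m) (suc n) k ℤ.*_)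
                             (trans (kspecℤ-≥ 0 (ℕP.<⇒≤ gt)) (cong +_ (kspec-no-variables _ (ℕP.m<n⇒0<n∸m gt)))))
                          (ℤP.*-zeroʳ (coef (suc m) (suc n) k))

kspec-product : ∀ s m n → lhs s m n ≡ rhs s m n
kspec-product = recurrent-unique lhs rhs lhs-recurrent rhs-recurrent base
  (λ s n → trans (cong +_ (ℕP.*-identityˡ (kspec n s))) (sym (rhs-left s n)))
  (λ s m → trans (cong +_ (ℕP.*-identityʳ (kspec m s))) (sym (rhs-right s m)))
  where
  base : ∀ m n → lhs 0 m n ≡ rhs 0 m n
  base zero    n       = trans (cong +_ (ℕP.*-identityˡ (kspec n 0))) (sym (rhs-left 0 n))
  base (suc m) zero    = trans (cong +_ (ℕP.*-identityʳ (kspec (suc m) 0))) (sym (rhs-right 0 (suc m)))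
  base (suc m) (suc n) = sym (Σℤ<-zero (suc (suc m)) (term 0 (suc m) (suc n)) (term-base m n))

coef-absorbed : ∀ m n k → k ≤ m →
  sign k ℤ.* + ((m + n ∸ k) C m) ℤ.* + (m C k) ℤ.* (+ (m + n) ℤ.- + (2 * k)) ≡ coef m n k ℤ.* + (m + n ∸ k)
coef-absorbed m n k k≤m = begin
  sign k ℤ.* + ((m + n ∸ k) C m) ℤ.* + (m C k) ℤ.* (+ (m + n) ℤ.- + (2 * k))
    ≡⟨ cong₂ (λ x y → sign k ℤ.* + x ℤ.* + y ℤ.* (+ (m + n) ℤ.- + (2 * k))) (sym (bin≡C N m)) (sym (bin≡C m k)) ⟩
  sign k ℤ.* + b₁ ℤ.* + b₂ ℤ.* (+ (m + n) ℤ.- + (2 * k))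
    ≡⟨ cong₂ (λ x y → sign k ℤ.* + b₁ ℤ.* + b₂ ℤ.* (+ x ℤ.- y))
             (sym (ℕP.m∸n+n≡m (ℕP.≤-trans k≤m (ℕP.m≤m+n m n)))) (ℤP.pos-* 2 k) ⟩
  sign k ℤ.* + b₁ ℤ.* + b₂ ℤ.* (+ N ℤ.+ + k ℤ.- + 2 ℤ.* + k)
    ≡⟨ expand (sign k) (+ b₁) (+ b₂) (+ N) (+ k) ⟩
  sign k ℤ.* (+ b₁ ℤ.* + b₂) ℤ.* + N ℤ.- sign k ℤ.* ((+ b₁ ℤ.* + b₂) ℤ.* + k)
    ≡⟨ cong₂ (λ x y → sign k ℤ.* x ℤ.* + N ℤ.- sign k ℤ.* y) (sym (ℤP.pos-* b₁ b₂)) absorbed ⟩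
  sign k ℤ.* + binProd m n k ℤ.* + N ℤ.- sign k ℤ.* (+ binProd⁻ m n k ℤ.* + N)
    ≡⟨ collect (sign k) (+ binProd m n k) (+ binProd⁻ m n k) (+ N) ⟩
  coef m n k ℤ.* + N ∎
  where
  open ≡-Reasoning
  N = m + n ∸ k
  b₁ = bin N m
  b₂ = bin m k
  absorbed : (+ b₁ ℤ.* + b₂) ℤ.* + k ≡ + binProd⁻ m n k ℤ.* + N
  absorbed = begin
    (+ b₁ ℤ.* + b₂) ℤ.* + k  ≡⟨ cong (ℤ._* + k) (sym (ℤP.pos-* b₁ b₂)) ⟩
    + binProd m n k ℤ.* + k  ≡⟨ sym (ℤP.pos-* (binProd m n k) k) ⟩
    + (binProd m n k * k)    ≡⟨ cong +_ (sym (binProd-absorb m n k)) ⟩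
    + (binProd⁻ m n k * N)   ≡⟨ ℤP.pos-* (binProd⁻ m n k) N ⟩
    + binProd⁻ m n k ℤ.* + N ∎
  expand : ∀ σ p q N k → σ ℤ.* p ℤ.* q ℤ.* (N ℤ.+ k ℤ.- + 2 ℤ.* k)
                         ≡ σ ℤ.* (p ℤ.* q) ℤ.* N ℤ.- σ ℤ.* ((p ℤ.* q) ℤ.* k)
  expand = ℤSolver.solve-∀
  collect : ∀ σ e e′ N → σ ℤ.* e ℤ.* N ℤ.- σ ℤ.* (e′ ℤ.* N) ≡ σ ℤ.* (e ℤ.- e′) ℤ.* N
  collect = ℤSolver.solve-∀

-- For n ≥ 1 the denominator m+n-k is positive, so the fraction is coef m n k.
statement-coefficient : ∀ m n k → 1 ≤ n → k ≤ m →
  frac (sign k ℤ.* + ((m + n ∸ k) C m) ℤ.* + (m C k) ℤ.* (+ (m + n) ℤ.- + (2 * k))) (m + n ∸ k) ≡ fromℤ (coef m n k)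
statement-coefficient m n k 1≤n k≤m = trans (cong (λ x → frac x (m + n ∸ k)) (coef-absorbed m n k k≤m))
  (frac-multiple (coef m n k) (ℕP.<-≤-trans 1≤n
    (ℕP.≤-trans (ℕP.m≤n+m n (m ∸ k)) (ℕP.≤-reflexive (sym (ℕP.+-∸-comm n k≤m))))))

fromℤ-Σ< : ∀ L (f : ℕ → ℤ) → fromℤ (Σℤ< L f) ≡ Σ< L (fromℤ ∘ f)
fromℤ-Σ< zero    f = refl
fromℤ-Σ< (suc L) f = trans (fromℤ-+ (f 0) (Σℤ< L (f ∘ suc))) (cong (fromℤ (f 0) ℚ.+_) (fromℤ-Σ< L (f ∘ suc)))

-- In the range k ≤ m a term of rhs is coef m n k · kspec (m+n-2k) s: when
-- 2k > m+n the coefficient vanishes since then n < k.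
term-fromℤ : ∀ m n k s → k ≤ m → fromℤ (term s m n k) ≡ fromℤ (coef m n k) ℚ.* fromℕ (kspec (m + n ∸ 2 * k) s)
term-fromℤ m n k s k≤m with k + k ≤? m + n
... | yes 2k≤ = trans (fromℤ-* (coef m n k) _) (cong (λ i → fromℤ (coef m n k) ℚ.* fromℤ i)
  (trans (kspecℤ-≥ s 2k≤) (cong (λ j → + kspec (m + n ∸ j) s) (cong (λ j → k + j) (sym (ℕP.+-identityʳ k))))))
... | no 2k≰ = trans (cong (λ c → fromℤ (c ℤ.* kspecℤ (index m n k) s)) vanish)
  (sym (trans (cong (λ c → fromℤ c ℚ.* fromℕ (kspec (m + n ∸ 2 * k) s)) vanish) (ℚP.*-zeroˡ (fromℕ (kspec (m + n ∸ 2 * k) s)))))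
  where
  n<k : n < k
  n<k = ℕP.+-cancelˡ-< k n k (ℕP.≤-<-trans (ℕP.+-monoˡ-≤ n k≤m) (ℕP.≰⇒> 2k≰))
  vanish : coef m n k ≡ + 0
  vanish = coef-vanish m n k (inj₂ n<k)

-- The theorem on coefficient sequences by cardinality: transform both sides,
-- where it becomes the product formula for kspec, and invert the transform.
mcoef-product : ∀ m n t →
  (mcoefℚ m ⊛ mcoefℚ n) t ≡ Σ< (suc m) (λ k → fromℤ (coef m n k) ℚ.* mcoefℚ (m + n ∸ 2 * k) t)
mcoef-product m n t = transform-injective t _ _ λ s → begin
  transform (mcoefℚ m ⊛ mcoefℚ n) s                    ≡⟨ transform-⊛ s (mcoefℚ m) (mcoefℚ n) ⟩
  transform (mcoefℚ m) s ℚ.* transform (mcoefℚ n) s    ≡⟨ cong₂ ℚ._*_ (transform-mcoef s m) (transform-mcoef s n) ⟩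
  fromℕ (kspec m s) ℚ.* fromℕ (kspec n s)              ≡⟨ sym (fromℕ-* (kspec m s) (kspec n s)) ⟩
  fromℤ (lhs s m n)                                    ≡⟨ cong fromℤ (kspec-product s m n) ⟩
  fromℤ (rhs s m n)                                    ≡⟨ fromℤ-Σ< (suc m) (term s m n) ⟩
  Σ< (suc m) (fromℤ ∘ term s m n)                      ≡⟨ Σ<-cong (suc m) (λ k k≤m → term-fromℤ m n k s (ℕP.≤-pred k≤m)) ⟩
  Σ< (suc m) (λ k → c k ℚ.* fromℕ (kspec (m + n ∸ 2 * k) s))
    ≡⟨ Σ<-cong (suc m) (λ k _ → cong (c k ℚ.*_) (sym (transform-mcoef s (m + n ∸ 2 * k)))) ⟩
  Σ< (suc m) (λ k → c k ℚ.* transform (mcoefℚ (m + n ∸ 2 * k)) s)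
    ≡⟨ sym (transform-Σ< (suc m) s c (λ k → mcoefℚ (m + n ∸ 2 * k))) ⟩
  transform (λ x → Σ< (suc m) (λ k → c k ℚ.* mcoefℚ (m + n ∸ 2 * k) x)) s ∎
  where
  open ≡-Reasoning
  c : ℕ → ℚ
  c k = fromℤ (coef m n k)

Σ<-upTo : ∀ L (g : ℕ → ℚ) → sumℚ (map g (upTo L)) ≡ Σ< L g
Σ<-upTo L g = go L (λ k → k)
  where
  go : ∀ L (f : ℕ → ℕ) → sumℚ (map g (applyUpTo f L)) ≡ Σ< L (g ∘ f)
  go zero    f = refl
  go (suc L) f = cong (g (f 0) ℚ.+_) (go L (f ∘ suc))

K0-mcoef : ∀ r I → AllPairs _<_ I → All (1 ≤_) I → K0 r I ≡ mcoefℚ r (length I)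
K0-mcoef r I I↑ I≥1 = cong fromℕ (Kcoef-mcoef r I I↑ I≥1)

-- The theorem: reduce the product to coefficient sequences, apply the product
-- formula there, and identify the coefficients.
lemma3p4 : (m n : ℕ) → 1 ≤ m → 1 ≤ n →
           (S : List ℕ) → Linked _<_ S → All (1 ≤_) S →
           (K0 m · K0 n) S
             ≡ sumℚ (map (λ k → frac ((ℤ.- + 1) ℤ.^ k ℤ.* + ((m + n ∸ k) C m) ℤ.* + (m C k) ℤ.* (+ (m + n) ℤ.- + (2 * k)))
                                     (m + n ∸ k)
                                ℚ.* K0 (m + n ∸ 2 * k) S)
                         (upTo (m + 1)))
lemma3p4 m n _ 1≤n S S-linked S≥1 = begin
  (K0 m · K0 n) S                    ≡⟨ product-pairSum S (K0 m) (K0 n) ⟩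
  pairSum S (K0 m) (K0 n)            ≡⟨ pairSum-⊛ S S↑ (K0 m) (K0 n) (mcoefℚ m) (mcoefℚ n) (onSublists m) (onSublists n) ⟩
  (mcoefℚ m ⊛ mcoefℚ n) (length S)  ≡⟨ mcoef-product m n (length S) ⟩
  Σ< (suc m) summand                 ≡⟨ cong (λ L → Σ< L summand) (ℕP.+-comm 1 m) ⟩
  Σ< (m + 1) summand                 ≡⟨ Σ<-cong (m + 1) (λ k k<m+1 → cong₂ ℚ._*_
                                          (sym (statement-coefficient m n k 1≤n (k≤m k<m+1)))
                                          (sym (K0-mcoef (m + n ∸ 2 * k) S S↑ S≥1))) ⟩
  Σ< (m + 1) statementTerm           ≡⟨ Σ<-upTo (m + 1) statementTerm ⟨
  sumℚ (map statementTerm (upTo (m + 1))) ∎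
  where
  open ≡-Reasoning
  summand : ℕ → ℚ
  summand k = fromℤ (coef m n k) ℚ.* mcoefℚ (m + n ∸ 2 * k) (length S)
  statementTerm : ℕ → ℚ
  statementTerm k = frac ((ℤ.- + 1) ℤ.^ k ℤ.* + ((m + n ∸ k) C m) ℤ.* + (m C k) ℤ.* (+ (m + n) ℤ.- + (2 * k))) (m + n ∸ k)
                    ℚ.* K0 (m + n ∸ 2 * k) S
  S↑ : AllPairs _<_ S
  S↑ = Linked⇒AllPairs ℕP.<-trans S-linked
  onSublists : ∀ r → All (λ I → K0 r I ≡ mcoefℚ r (length I)) (sublists S)
  onSublists r = All.zipWith (λ (I↑ , I≥1) → K0-mcoef r _ I↑ I≥1) (sublists-increasing S↑ , sublists-All S≥1)
  k≤m : ∀ {k} → k < m + 1 → k ≤ m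
  k≤m {k} k<m+1 = ℕP.≤-pred (subst (k <_) (ℕP.+-comm m 1) k<m+1)
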